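{- Let $G$ be a finite graph (loops and multi-edges allowed), let $j$ be a nonnegative integer, and let $\{M_1,\dots,M_k\}$ be the set of all set partitions of $V(G)$ that are $i$-maximal for some $0 \le i \le j$. Then $$\sum_{i=0}^{j} [(1+t)^i]\, XB_G = \sum_{\emptyset \neq S \subseteq [k]} (-1)^{|S|-1}\, r_{\lambda\left(\bigwedge_{i\in S} M_i\right)}.$$
   Context: For a set partition $\pi$ of $V(G)$, $e(\pi)$ is the number of edges of $G$ having both endpoints in the same block of $\pi$ (counted with multiplicity), and $\lambda(\pi)$ is the integer partition of block sizes. A partition $\pi$ of $V(G)$ is $j$-maximal if $e(\pi) = j$ and there is at least one edge of $G$ between every pair of distinct blocks of $\pi$. For set partitions $\pi,\rho$, $\pi\wedge\rho$ is the partition in which two elements are in the same block iff they are in the same block in both $\pi$ and $\rho$. For an integer partition $\lambda$, $n_i(\lambda)$ is the number of parts equal to $i$ and $\widetilde m_\lambda = (\prod_i n_i(\lambda)!) m_\lambda$ (augmented monomial symmetric function). The Tutte symmetric function is $XB_G = \sum_{\pi \vdash V(G)} (1+t)^{e(\pi)} \widetilde{m}_{\lambda(\pi)}$, an element of $\Lambda[t]$; writing each element of $\Lambda[t]$ uniquely as $\sum_i (1+t)^i f_i$ with $f_i$ symmetric functions, $[(1+t)^i]XB_G$ denotes $f_i$. The chromatic symmetric function of a graph $H$ is $X_H = \sum_\kappa \prod_{v} x_{\kappa(v)}$ over proper colorings $\kappa: V(H)\to\mathbb{N}$; $G_\lambda$ is the complete multipartite graph with stable sets of sizes $\lambda_1,\dots,\lambda_k$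 and all edges between different stable sets, and $r_\lambda = X_{G_\lambda}$. $[k] = \{1,\dots,k\}$. -}

module Defs where

open import Data.Bool using (Bool; true; false; _∧_; _∨_; not; if_then_else_)
open import Data.Nat using (ℕ; zero; suc; _+_; _∸_; _≡ᵇ_; _<ᵇ_)
open import Data.Fin using (Fin; toℕ; splitAt)
open import Data.Fin.Properties using (_≟_)
open import Data.Integer using (ℤ; +_; -_; _*_; _^_) renaming (_+_ to _+ℤ_)
open import Data.List using (List; []; _∷_; [_]; map; concatMap; filterᵇ; length; allFin; upTo; lookup; foldr; _++_)
open import Data.Bool.ListAction using (all; any)
open import Data.Nat.ListAction using (sum)
open import Relation.Binary.PropositionalEquality using (_≡_)
open import Data.Product using (_×_; _,_)
open import Data.Sum using (inj₁; inj₂)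
open import Relation.Nullary.Decidable using (⌊_⌋)
import Data.Vec.Functional as VF

allFuns : {A : Set} → (n : ℕ) → List A → List (Fin n → A)
allFuns zero xs = [ (λ ()) ]
allFuns (suc n) xs = concatMap (λ a → map (λ f → a VF.∷ f) (allFuns n xs)) xs

_==_ : {n : ℕ} → Fin n → Fin n → Bool
i == j = ⌊ i ≟ j ⌋

_⇒ᵇ_ : Bool → Bool → Bool
a ⇒ᵇ b = not a ∨ b

countᵇ : {A : Set} → (A → Bool) → List A → ℕ
countᵇ p xs = length (filterᵇ p xs)

-- Finite graphs (loops and multi-edges allowed): vertex set Fin n,
-- edge multiset given as a list of (unordered) endpoint pairs.

record Graph : Set where
  field
    n     : ℕ
    edges : List (Fin n × Fin n)
open Graph public

-- Set partitions of Fin n, as (Boolean) equivalence relations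
-- ("same block"). Each set partition corresponds to exactly one relation.

BRel : ℕ → Set
BRel n = Fin n → Fin n → Bool

isEquivᵇ : {n : ℕ} → BRel n → Bool
isEquivᵇ {n} R =
  all (λ u → R u u) (allFin n) ∧
  all (λ u → all (λ v → R u v ⇒ᵇ R v u) (allFin n)) (allFin n) ∧
  all (λ u → all (λ v → all (λ w → (R u v ∧ R v w) ⇒ᵇ R u w) (allFin n)) (allFin n)) (allFin n)

setPartitions : (n : ℕ) → List (BRel n)
setPartitions n = filterᵇ isEquivᵇ (allFuns n (allFuns n (true ∷ false ∷ [])))

-- λ(π): block sizes; one entry per block (listed by the block's least
-- element).  An integer partition is represented as a list of its parts;
-- all functions of integer partitions below are invariant under reordering.
blockSizes : {n : ℕ} → BRel n → List ℕ
blockSizes {n} π =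
  map (λ v → countᵇ (π v) (allFin n))
      (filterᵇ (λ v → not (any (λ u → (toℕ u <ᵇ toℕ v) ∧ π u v) (allFin n))) (allFin n))

eP : (G : Graph) → BRel (n G) → ℕ
eP G π = countᵇ (λ { (a , b) → π a b }) (edges G)

edgeBetweenAllBlocks : (G : Graph) → BRel (n G) → Bool
edgeBetweenAllBlocks G π =
  all (λ u → all (λ v → not (π u v) ⇒ᵇ
        any (λ { (a , b) → (π a u ∧ π b v) ∨ (π a v ∧ π b u) }) (edges G))
      (allFin (n G))) (allFin (n G))

isMaximal : (G : Graph) → ℕ → BRel (n G) → Bool
isMaximal G j π = (eP G π ≡ᵇ j) ∧ edgeBetweenAllBlocks G π

meet : {n : ℕ} → List (BRel n) → BRel n
meet = foldr (λ π ρ u v → π u v ∧ ρ u v) (λ _ _ → true)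

-- A symmetric function f is
-- represented by its coefficients: SF N α = coefficient of the monomial
-- x_1^{α 1} ... x_N^{α N} in f (equivalently, in its specialisation to
-- the variables x_1..x_N).  Every monomial arises this way for some N.

SF : Set
SF = (N : ℕ) → (Fin N → ℕ) → ℤ

_≈SF_ : SF → SF → Set
f ≈SF g = (N : ℕ) (α : Fin N → ℕ) → f N α ≡ g N α
infix 4 _≈SF_

0SF : SF
0SF N α = + 0

_+SF_ : SF → SF → SF
(f +SF g) N α = f N α +ℤ g N α

_·SF_ : ℤ → SF → SF
(c ·SF f) N α = c * f N α

ΣSF : {A : Set} → List A → (A → SF) → SF
ΣSF xs f = foldr (λ x acc → f x +SF acc) 0SF xs

expo : {m N : ℕ} → (Fin m → Fin N) → Fin N → ℕ
expo {m} κ k = countᵇ (λ v → κ v == k) (allFin m)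

sameExpo : {N : ℕ} → (Fin N → ℕ) → (Fin N → ℕ) → Bool
sameExpo {N} α β = all (λ k → α k ≡ᵇ β k) (allFin N)

-- augmented monomial symmetric function m̃_λ = Σ over sequences of
-- distinct indices (i_1,...,i_l) of x_{i_1}^{λ_1} ... x_{i_l}^{λ_l}
mtilde : List ℕ → SF
mtilde lam N α = + countᵇ ok (allFuns (length lam) (allFin N))
  where
  ok : (Fin (length lam) → Fin N) → Bool
  ok c = all (λ i → all (λ j → (c i == c j) ⇒ᵇ (i == j)) (allFin (length lam))) (allFin (length lam))
       ∧ all (λ k → α k ≡ᵇ sum (map (lookup lam) (filterᵇ (λ i → c i == k) (allFin (length lam))))) (allFin N)

chromatic : Graph → SF
chromatic H N α = + countᵇ ok (allFuns (n H) (allFin N))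
  where
  ok : (Fin (n H) → Fin N) → Bool
  ok κ = all (λ { (a , b) → not (κ a == κ b) }) (edges H) ∧ sameExpo α (expo κ)

-- complete multipartite graph G_λ: vertices Fin (λ_1 + ... + λ_k), the
-- first λ_1 in stable set 0, the next λ_2 in stable set 1, etc.;
-- one edge between every pair of vertices in different stable sets.
partOf : (lam : List ℕ) → Fin (sum lam) → ℕ
partOf [] ()
partOf (p ∷ lam) u with splitAt p u
... | inj₁ _ = 0
... | inj₂ w = suc (partOf lam w)

completeMultipartite : List ℕ → Graph
completeMultipartite lam = record
  { n = sum lam
  ; edges = concatMap (λ u → map (λ v → (u , v))
              (filterᵇ (λ v → (toℕ u <ᵇ toℕ v) ∧ not (partOf lam u ≡ᵇ partOf lam v)) (allFin (sum lam))))
              (allFin (sum lam)) }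

r : List ℕ → SF
r lam = chromatic (completeMultipartite lam)

-- Tutte symmetric function XB_G = Σ_π (1+t)^{e(π)} m̃_{λ(π)} ∈ Λ[t],
-- given by its (unique) coefficients in the basis (1+t)^i over Λ:
-- tutteCoeff G i = [(1+t)^i] XB_G.
tutteCoeff : Graph → ℕ → SF
tutteCoeff G i = ΣSF (setPartitions (n G)) (λ π → if eP G π ≡ᵇ i then mtilde (blockSizes π) else 0SF)

maximalUpTo : (G : Graph) → ℕ → List (BRel (n G))
maximalUpTo G j = filterᵇ (λ π → any (λ i → isMaximal G i π) (upTo (suc j))) (setPartitions (n G))

-- all nonempty sub-lists (= nonempty subsets S ⊆ [k] of the index set)
nonemptySubs : {A : Set} → List A → List (List A)
nonemptySubs [] = []
nonemptySubs (x ∷ xs) = map (x ∷_) ([] ∷ nonemptySubs xs) ++ nonemptySubs xs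

{-# OPTIONS --safe #-}
module Submission where


-- Fix an exponent vector α and expand both sides over the colourings κ of V(G) with
-- colour multiplicities α; write ker κ for the partition into colour classes.  The coefficient
-- of x^α in m̃_λ(π) is the number of such κ with ker κ = π, so the left side counts the κ with
-- e(ker κ) ≤ j.  The coefficient of x^α in r_λ(M) is the number of such κ whose kernel refines
-- M (a colouring of G_λ(M) is proper iff no colour meets two stable sets), and r of a meet
-- counts kernels refining every member; so by inclusion–exclusion the right side counts the κ
-- whose kernel refines some M_i.  The two conditions agree: refining can only lower e, and a
-- partition π with e(π) ≤ j can be coarsened, by merging two blocks joined by no edge (which
-- keeps e), until it is i-maximal for i = e(π).

open import Defs
import Data.Fin.Properties as Fin
import Data.Integer.Properties as ℤ
import Data.Nat.Properties as ℕ
open import Algebra.Properties.CommutativeSemigroup ℕ.+-commutativeSemigroup using () renaming (interchange to +-interchange)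
open import Algebra.Properties.CommutativeSemigroup ℤ.+-commutativeSemigroup using () renaming (interchange to ℤ+-interchange)
open import Data.Bool using (Bool; true; false; _∧_; _∨_; not; if_then_else_; T?)
import Data.Bool as Bool
open import Data.Bool.ListAction using (all; any)
open import Data.Bool.Properties using (T-≡; ∧-assoc)
open import Data.Empty using (⊥; ⊥-elim)
open import Data.Fin using (Fin; zero; suc; toℕ; splitAt; _↑ˡ_; _↑ʳ_)
open import Data.Integer using (ℤ; +_; -_; _^_) renaming (_+_ to _+ℤ_; _*_ to _*ℤ_)
open import Data.Integer.Tactic.RingSolver using (solve-∀)
open import Data.List using (List; []; _∷_; map; concatMap; filterᵇ; length; allFin; upTo; lookup; foldr; _++_)
open import Data.List.Membership.Propositional using (_∈_)
open import Data.List.Membership.Propositional.Properties using (∈-allFin; ∈-upTo⁺; ∈-upTo⁻; ∈-lookup; ∈-filter⁺; ∈-filter⁻)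
open import Data.List.Properties using (map-++; map-∘; map-tabulate; map-applyUpTo)
open import Data.List.Relation.Unary.All as All using (All; []; _∷_)
import Data.List.Relation.Unary.All.Properties as All
open import Data.List.Relation.Unary.AllPairs using (_∷_)
open import Data.List.Relation.Unary.Any using (here; there)
import Data.List.Relation.Unary.Any as Any
import Data.List.Relation.Unary.Any.Properties as Any
open import Data.List.Relation.Unary.Unique.Propositional using (Unique)
import Data.List.Relation.Unary.Unique.Propositional.Properties as Unique
open import Data.Nat using (ℕ; zero; suc; _+_; _*_; _∸_; _≤_; _<_; z≤n; s≤s; _≡ᵇ_; _<ᵇ_)
open import Data.Nat.ListAction using (sum)
open import Data.Nat.ListAction.Properties using (sum-++)
import Data.Nat.Tactic.RingSolver as ℕ-Solver
open import Data.Product using (Σ; _×_; _,_; proj₁; proj₂)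
open import Data.Sum using (_⊎_; inj₁; inj₂)
import Data.Vec.Functional as VF
open import Function using (_∘_; Equivalence)
open import Relation.Binary using (tri<; tri≈; tri>)
open import Relation.Binary.Definitions using (DecidableEquality)
open import Relation.Binary.PropositionalEquality
open import Relation.Nullary using (yes; no; ¬_)
open import Relation.Nullary.Decidable using (⌊_⌋)

⟦_⟧ : Bool → ℕ
⟦ true ⟧ = 1
⟦ false ⟧ = 0

∧-elimˡ : ∀ {a b} → a ∧ b ≡ true → a ≡ true
∧-elimˡ {true} _ = refl

∧-elimʳ : ∀ {a b} → a ∧ b ≡ true → b ≡ true
∧-elimʳ {true} e = e

∧-intro : ∀ {a b} → a ≡ true → b ≡ true → a ∧ b ≡ true
∧-intro refl refl = refl

∨-introˡ : ∀ {a b} → a ≡ true → a ∨ b ≡ true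
∨-introˡ refl = refl

∨-introʳ : ∀ {a b} → b ≡ true → a ∨ b ≡ true
∨-introʳ {true} _ = refl
∨-introʳ {false} e = e

∨-elim : ∀ {a b} → a ∨ b ≡ true → a ≡ true ⊎ b ≡ true
∨-elim {true} _ = inj₁ refl
∨-elim {false} e = inj₂ e

⇒ᵇ-elim : ∀ {a b} → a ⇒ᵇ b ≡ true → a ≡ true → b ≡ true
⇒ᵇ-elim {true} e refl = e

⇒ᵇ-intro : ∀ {a b} → (a ≡ true → b ≡ true) → a ⇒ᵇ b ≡ true
⇒ᵇ-intro {true} f = f refl
⇒ᵇ-intro {false} _ = refl

⇒ᵇ-false : ∀ {a b} → a ⇒ᵇ b ≡ false → a ≡ true × b ≡ false
⇒ᵇ-false {true} e = refl , e

not-true⇒false : ∀ {a} → not a ≡ true → a ≡ false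
not-true⇒false {false} _ = refl

not-false⇒true : ∀ {a} → not a ≡ false → a ≡ true
not-false⇒true {true} _ = refl

false⇒not-true : ∀ {a} → a ≡ false → not a ≡ true
false⇒not-true refl = refl

false≢true : ∀ {a} → a ≡ false → a ≡ true → ⊥
false≢true refl ()

¬true⇒false : ∀ {a} → ¬ a ≡ true → a ≡ false
¬true⇒false {true} ¬t = ⊥-elim (¬t refl)
¬true⇒false {false} _ = refl

true-ext : ∀ {a b} → (a ≡ true → b ≡ true) → (b ≡ true → a ≡ true) → a ≡ b
true-ext {true} f _ = sym (f refl)
true-ext {false} {true} _ g = g refl
true-ext {false} {false} _ _ = refl

⟦∧⟧ : ∀ a b → ⟦ a ∧ b ⟧ ≡ ⟦ a ⟧ * ⟦ b ⟧
⟦∧⟧ true true = refl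
⟦∧⟧ true false = refl
⟦∧⟧ false _ = refl

module _ {A : Set} (_≟_ : DecidableEquality A) where

  ≟-true⇒≡ : ∀ {a b} → ⌊ a ≟ b ⌋ ≡ true → a ≡ b
  ≟-true⇒≡ {a} {b} e with a ≟ b
  ... | yes a≡b = a≡b

  ≡⇒≟-true : ∀ {a b} → a ≡ b → ⌊ a ≟ b ⌋ ≡ true
  ≡⇒≟-true {a} {b} a≡b with a ≟ b
  ... | yes _ = refl
  ... | no a≢b = ⊥-elim (a≢b a≡b)

==⇒≡ : {n : ℕ} {a b : Fin n} → a == b ≡ true → a ≡ b
==⇒≡ = ≟-true⇒≡ Fin._≟_

≡⇒== : {n : ℕ} {a b : Fin n} → a ≡ b → a == b ≡ true
≡⇒== = ≡⇒≟-true Fin._≟_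

==-refl : {n : ℕ} (a : Fin n) → a == a ≡ true
==-refl a = ≡⇒== refl

==-sym : {n : ℕ} {a b : Fin n} → a == b ≡ true → b == a ≡ true
==-sym e = ≡⇒== (sym (==⇒≡ e))

==-trans : {n : ℕ} {a b c : Fin n} → a == b ≡ true → b == c ≡ true → a == c ≡ true
==-trans e f = ≡⇒== (trans (==⇒≡ e) (==⇒≡ f))

≢⇒==false : {n : ℕ} {a b : Fin n} → ¬ a ≡ b → a == b ≡ false
≢⇒==false a≢b = ¬true⇒false (a≢b ∘ ==⇒≡)

==-suc : {n : ℕ} (a b : Fin n) → (suc a == suc b) ≡ (a == b)
==-suc a b = true-ext (≡⇒== ∘ Fin.suc-injective ∘ ==⇒≡) (≡⇒== ∘ cong suc ∘ ==⇒≡)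

≡ᵇ⇒≡ : ∀ {m n} → (m ≡ᵇ n) ≡ true → m ≡ n
≡ᵇ⇒≡ {m} {n} e = ℕ.≡ᵇ⇒≡ m n (Equivalence.from T-≡ e)

≡⇒≡ᵇ : ∀ {m n} → m ≡ n → (m ≡ᵇ n) ≡ true
≡⇒≡ᵇ {m} {n} e = Equivalence.to T-≡ (ℕ.≡⇒≡ᵇ m n e)

<ᵇ⇒< : ∀ {m n} → (m <ᵇ n) ≡ true → m < n
<ᵇ⇒< {m} {n} e = ℕ.<ᵇ⇒< m n (Equivalence.from T-≡ e)

<⇒<ᵇ : ∀ {m n} → m < n → (m <ᵇ n) ≡ true
<⇒<ᵇ lt = Equivalence.to T-≡ (ℕ.<⇒<ᵇ lt)

≡ᵇ-sym : ∀ a b → (a ≡ᵇ b) ≡ (b ≡ᵇ a)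
≡ᵇ-sym a b = true-ext (≡⇒≡ᵇ {b} {a} ∘ sym ∘ ≡ᵇ⇒≡ {a} {b}) (≡⇒≡ᵇ {a} {b} ∘ sym ∘ ≡ᵇ⇒≡ {b} {a})

module _ {A : Set} where

  ∈-filterᵇ⁺ : (p : A → Bool) {xs : List A} {x : A} → x ∈ xs → p x ≡ true → x ∈ filterᵇ p xs
  ∈-filterᵇ⁺ p x∈xs px = ∈-filter⁺ (T? ∘ p) x∈xs (Equivalence.from T-≡ px)

  ∈-filterᵇ⁻ : (p : A → Bool) {xs : List A} {x : A} → x ∈ filterᵇ p xs → x ∈ xs × p x ≡ true
  ∈-filterᵇ⁻ p x∈ with ∈-filter⁻ (T? ∘ p) x∈
  ... | x∈xs , px = x∈xs , Equivalence.to T-≡ px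

  all-elim : (f : A → Bool) (xs : List A) → all f xs ≡ true → ∀ {x} → x ∈ xs → f x ≡ true
  all-elim f (y ∷ ys) e (here refl) = ∧-elimˡ e
  all-elim f (y ∷ ys) e (there x∈) = all-elim f ys (∧-elimʳ {f y} e) x∈

  all-intro : (f : A → Bool) (xs : List A) → (∀ {x} → x ∈ xs → f x ≡ true) → all f xs ≡ true
  all-intro f [] _ = refl
  all-intro f (y ∷ ys) h = ∧-intro (h (here refl)) (all-intro f ys (h ∘ there))

  all-false : (f : A → Bool) (xs : List A) → all f xs ≡ false → Σ A λ x → x ∈ xs × f x ≡ false
  all-false f (y ∷ ys) e with f y in fy
  ... | false = y , here refl , fy
  ... | true with all-false f ys e
  ...   | x , x∈ , fx = x , there x∈ , fx

  any-elim : (f : A → Bool) (xs : List A) → any f xs ≡ true → Σ A λ x → x ∈ xs × f x ≡ true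
  any-elim f (y ∷ ys) e with f y in fy
  ... | true = y , here refl , fy
  ... | false with any-elim f ys e
  ...   | x , x∈ , fx = x , there x∈ , fx

  any-intro : (f : A → Bool) (xs : List A) → ∀ {x} → x ∈ xs → f x ≡ true → any f xs ≡ true
  any-intro f (y ∷ ys) (here refl) fx = ∨-introˡ fx
  any-intro f (y ∷ ys) (there x∈) fx = ∨-introʳ {f y} (any-intro f ys x∈ fx)

  all-cong : (f g : A → Bool) (xs : List A) → (∀ x → f x ≡ g x) → all f xs ≡ all g xs
  all-cong f g [] _ = refl
  all-cong f g (y ∷ ys) e = cong₂ _∧_ (e y) (all-cong f g ys e)

  any-cong : (f g : A → Bool) (xs : List A) → (∀ x → f x ≡ g x) → any f xs ≡ any g xs
  any-cong f g [] _ = refl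
  any-cong f g (y ∷ ys) e = cong₂ _∨_ (e y) (any-cong f g ys e)

  all-++ : (f : A → Bool) (xs ys : List A) → all f (xs ++ ys) ≡ all f xs ∧ all f ys
  all-++ f [] ys = refl
  all-++ f (x ∷ xs) ys = trans (cong (f x ∧_) (all-++ f xs ys)) (sym (∧-assoc (f x) (all f xs) (all f ys)))

  all-filterᵇ : (f p : A → Bool) (xs : List A) → all f (filterᵇ p xs) ≡ all (λ x → p x ⇒ᵇ f x) xs
  all-filterᵇ f p [] = refl
  all-filterᵇ f p (x ∷ xs) with p x
  ... | true = cong (f x ∧_) (all-filterᵇ f p xs)
  ... | false = all-filterᵇ f p xs

module _ {A B : Set} where

  all-concatMap : (f : B → Bool) (g : A → List B) (xs : List A) → all f (concatMap g xs) ≡ all (λ x → all f (g x)) xs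
  all-concatMap f g [] = refl
  all-concatMap f g (x ∷ xs) = trans (all-++ f (g x) (concatMap g xs)) (cong (all f (g x) ∧_) (all-concatMap f g xs))

  all-map : (f : B → Bool) (g : A → B) (xs : List A) → all f (map g xs) ≡ all (f ∘ g) xs
  all-map f g [] = refl
  all-map f g (x ∷ xs) = cong (f (g x) ∧_) (all-map f g xs)

allFin-elim : {n : ℕ} (f : Fin n → Bool) → all f (allFin n) ≡ true → ∀ x → f x ≡ true
allFin-elim {n} f e x = all-elim f (allFin n) e (∈-allFin x)

allFin-intro : {n : ℕ} (f : Fin n → Bool) → (∀ x → f x ≡ true) → all f (allFin n) ≡ true
allFin-intro {n} f h = all-intro f (allFin n) (λ {x} _ → h x)

⟦⟧-mono : ∀ {a b} → (a ≡ true → b ≡ true) → ⟦ a ⟧ ≤ ⟦ b ⟧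
⟦⟧-mono {true} a⇒b rewrite a⇒b refl = s≤s z≤n
⟦⟧-mono {false} _ = z≤n

∑ : {A : Set} → List A → (A → ℕ) → ℕ
∑ xs f = sum (map f xs)

module _ {A : Set} where

  countᵇ≡∑ : (p : A → Bool) (xs : List A) → countᵇ p xs ≡ ∑ xs (λ x → ⟦ p x ⟧)
  countᵇ≡∑ p [] = refl
  countᵇ≡∑ p (x ∷ xs) with p x
  ... | true = cong suc (countᵇ≡∑ p xs)
  ... | false = countᵇ≡∑ p xs

  ∑-cong : {f g : A → ℕ} (xs : List A) → (∀ x → f x ≡ g x) → ∑ xs f ≡ ∑ xs g
  ∑-cong [] _ = refl
  ∑-cong (x ∷ xs) e = cong₂ _+_ (e x) (∑-cong xs e)

  ∑-cong∈ : {f g : A → ℕ} (xs : List A) → (∀ {x} → x ∈ xs → f x ≡ g x) → ∑ xs f ≡ ∑ xs g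
  ∑-cong∈ [] _ = refl
  ∑-cong∈ (x ∷ xs) e = cong₂ _+_ (e (here refl)) (∑-cong∈ xs (e ∘ there))

  ∑-zero : (xs : List A) {f : A → ℕ} → (∀ x → f x ≡ 0) → ∑ xs f ≡ 0
  ∑-zero [] _ = refl
  ∑-zero (x ∷ xs) e = cong₂ _+_ (e x) (∑-zero xs e)

  ∑-+ : (f g : A → ℕ) (xs : List A) → ∑ xs (λ x → f x + g x) ≡ ∑ xs f + ∑ xs g
  ∑-+ f g [] = refl
  ∑-+ f g (x ∷ xs) = begin
    (f x + g x) + ∑ xs (λ x → f x + g x) ≡⟨ cong (_+_ (f x + g x)) (∑-+ f g xs) ⟩
    (f x + g x) + (∑ xs f + ∑ xs g)      ≡⟨ +-interchange (f x) (g x) (∑ xs f) (∑ xs g) ⟩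
    (f x + ∑ xs f) + (g x + ∑ xs g)      ∎
    where open ≡-Reasoning

  ∑-*ˡ : (c : ℕ) (f : A → ℕ) (xs : List A) → ∑ xs (λ x → c * f x) ≡ c * ∑ xs f
  ∑-*ˡ c f [] = sym (ℕ.*-zeroʳ c)
  ∑-*ˡ c f (x ∷ xs) = trans (cong (_+_ (c * f x)) (∑-*ˡ c f xs)) (sym (ℕ.*-distribˡ-+ c (f x) (∑ xs f)))

  ∑-++ : (f : A → ℕ) (xs ys : List A) → ∑ (xs ++ ys) f ≡ ∑ xs f + ∑ ys f
  ∑-++ f xs ys = trans (cong sum (map-++ f xs ys)) (sum-++ (map f xs) (map f ys))

  ∑-filterᵇ : (p : A → Bool) (f : A → ℕ) (xs : List A) → ∑ (filterᵇ p xs) f ≡ ∑ xs (λ x → ⟦ p x ⟧ * f x)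
  ∑-filterᵇ p f [] = refl
  ∑-filterᵇ p f (x ∷ xs) with p x
  ... | true = cong₂ _+_ (sym (ℕ.+-identityʳ (f x))) (∑-filterᵇ p f xs)
  ... | false = ∑-filterᵇ p f xs

  ∑-mono : {f g : A → ℕ} (xs : List A) → (∀ x → f x ≤ g x) → ∑ xs f ≤ ∑ xs g
  ∑-mono [] _ = z≤n
  ∑-mono (x ∷ xs) le = ℕ.+-mono-≤ (le x) (∑-mono xs le)

  ∑-mono-< : {f g : A → ℕ} (xs : List A) → (∀ x → f x ≤ g x) → ∀ {y} → y ∈ xs → f y < g y → ∑ xs f < ∑ xs g
  ∑-mono-< (x ∷ xs) le (here refl) lt = ℕ.+-mono-<-≤ lt (∑-mono xs le)
  ∑-mono-< (x ∷ xs) le (there y∈) lt = ℕ.+-mono-≤-< (le x) (∑-mono-< xs le y∈ lt)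

  ∑-positive : (f : A → ℕ) (xs : List A) {x : A} → x ∈ xs → 1 ≤ f x → 1 ≤ ∑ xs f
  ∑-positive f (y ∷ ys) (here refl) le = ℕ.≤-trans le (ℕ.m≤m+n _ _)
  ∑-positive f (y ∷ ys) (there x∈) le = ℕ.≤-trans (∑-positive f ys x∈ le) (ℕ.m≤n+m _ _)

  ∑-witness : (p : A → Bool) (xs : List A) → ∑ xs (λ x → ⟦ p x ⟧) ≡ 1 → Σ A λ x → x ∈ xs × p x ≡ true
  ∑-witness p (y ∷ ys) e with p y in py
  ... | true = y , here refl , py
  ... | false with ∑-witness p ys e
  ...   | x , x∈ , px = x , there x∈ , px

  countᵇ-cong∈ : {p q : A → Bool} (xs : List A) → (∀ {x} → x ∈ xs → p x ≡ q x) → countᵇ p xs ≡ countᵇ q xs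
  countᵇ-cong∈ {p} {q} xs e =
    trans (countᵇ≡∑ p xs) (trans (∑-cong∈ xs (cong ⟦_⟧ ∘ e)) (sym (countᵇ≡∑ q xs)))

  countᵇ-cong : {p q : A → Bool} (xs : List A) → (∀ x → p x ≡ q x) → countᵇ p xs ≡ countᵇ q xs
  countᵇ-cong xs e = countᵇ-cong∈ xs (λ {x} _ → e x)

  countᵇ-mono : {p q : A → Bool} (xs : List A) → (∀ x → p x ≡ true → q x ≡ true) → countᵇ p xs ≤ countᵇ q xs
  countᵇ-mono {p} {q} xs p⇒q = subst₂ _≤_ (sym (countᵇ≡∑ p xs)) (sym (countᵇ≡∑ q xs))
    (∑-mono xs (λ x → ⟦⟧-mono (p⇒q x)))

module _ {A B : Set} where

  ∑-map : (f : A → B) (g : B → ℕ) (xs : List A) → ∑ (map f xs) g ≡ ∑ xs (g ∘ f)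
  ∑-map f g xs = cong sum (sym (map-∘ xs))

  ∑-concatMap : (f : A → List B) (g : B → ℕ) (xs : List A) → ∑ (concatMap f xs) g ≡ ∑ xs (λ x → ∑ (f x) g)
  ∑-concatMap f g [] = refl
  ∑-concatMap f g (x ∷ xs) = trans (∑-++ g (f x) (concatMap f xs)) (cong (_+_ (∑ (f x) g)) (∑-concatMap f g xs))

  ∑-swap : (xs : List A) (ys : List B) (f : A → B → ℕ) → ∑ xs (λ x → ∑ ys (f x)) ≡ ∑ ys (λ y → ∑ xs (λ x → f x y))
  ∑-swap [] ys f = sym (∑-zero ys (λ _ → refl))
  ∑-swap (x ∷ xs) ys f = trans (cong (_+_ (∑ ys (f x))) (∑-swap xs ys f)) (sym (∑-+ (f x) (λ y → ∑ xs (λ x → f x y)) ys))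

∑-allFin-suc : {n : ℕ} (f : Fin (suc n) → ℕ) → ∑ (allFin (suc n)) f ≡ f zero + ∑ (allFin n) (f ∘ suc)
∑-allFin-suc f = cong (_+_ (f zero)) (cong sum (trans (map-tabulate suc f) (sym (map-tabulate (λ x → x) (f ∘ suc)))))

∑-allFin-δ : {n : ℕ} (a : Fin n) → ∑ (allFin n) (λ x → ⟦ a == x ⟧) ≡ 1
∑-allFin-δ {suc n} zero =
  trans (∑-allFin-suc {n} (λ x → ⟦ zero == x ⟧)) (cong suc (∑-zero (allFin n) (λ x → cong ⟦_⟧ (≢⇒==false {a = zero} {suc x} λ ()))))
∑-allFin-δ {suc n} (suc a) = begin
  ∑ (allFin (suc n)) (λ x → ⟦ suc a == x ⟧)    ≡⟨ ∑-allFin-suc {n} (λ x → ⟦ suc a == x ⟧) ⟩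
  ⟦ suc a == zero ⟧ + ∑ (allFin n) (λ x → ⟦ suc a == suc x ⟧)
    ≡⟨ cong₂ _+_ (cong ⟦_⟧ (≢⇒==false {a = suc a} {zero} λ ())) (∑-cong (allFin n) (cong ⟦_⟧ ∘ ==-suc a)) ⟩
  ∑ (allFin n) (λ x → ⟦ a == x ⟧)              ≡⟨ ∑-allFin-δ a ⟩
  1                                            ∎
  where open ≡-Reasoning

∑-upTo-suc : (m : ℕ) (g : ℕ → ℕ) → ∑ (upTo (suc m)) g ≡ g 0 + ∑ (upTo m) (g ∘ suc)
∑-upTo-suc m g = cong (_+_ (g 0)) (cong sum (trans (map-applyUpTo suc g m) (sym (map-applyUpTo (λ i → i) (g ∘ suc) m))))

∑-upTo-δ : (m e : ℕ) → ∑ (upTo m) (λ i → ⟦ e ≡ᵇ i ⟧) ≡ ⟦ e <ᵇ m ⟧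
∑-upTo-δ zero e = refl
∑-upTo-δ (suc m) zero = trans (∑-upTo-suc m (λ i → ⟦ 0 ≡ᵇ i ⟧)) (cong suc (∑-zero (upTo m) (λ _ → refl)))
∑-upTo-δ (suc m) (suc e) = trans (∑-upTo-suc m (λ i → ⟦ suc e ≡ᵇ i ⟧)) (∑-upTo-δ m e)

∑ℤ : {A : Set} → List A → (A → ℤ) → ℤ
∑ℤ xs f = foldr (λ x acc → f x +ℤ acc) (+ 0) xs

ΣSF-apply : {A : Set} (xs : List A) (f : A → SF) (N : ℕ) (α : Fin N → ℕ) → ΣSF xs f N α ≡ ∑ℤ xs (λ x → f x N α)
ΣSF-apply [] f N α = refl
ΣSF-apply (x ∷ xs) f N α = cong (f x N α +ℤ_) (ΣSF-apply xs f N α)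

module _ {A : Set} where

  ∑ℤ-cong : {f g : A → ℤ} (xs : List A) → (∀ x → f x ≡ g x) → ∑ℤ xs f ≡ ∑ℤ xs g
  ∑ℤ-cong [] _ = refl
  ∑ℤ-cong (x ∷ xs) e = cong₂ _+ℤ_ (e x) (∑ℤ-cong xs e)

  ∑ℤ-congᴬ : {P : A → Set} {f g : A → ℤ} (xs : List A) → All P xs → (∀ x → P x → f x ≡ g x) → ∑ℤ xs f ≡ ∑ℤ xs g
  ∑ℤ-congᴬ [] [] _ = refl
  ∑ℤ-congᴬ (x ∷ xs) (px ∷ pxs) e = cong₂ _+ℤ_ (e x px) (∑ℤ-congᴬ xs pxs e)

  ∑ℤ-ℕ : (f : A → ℕ) (xs : List A) → ∑ℤ xs (λ x → + f x) ≡ + ∑ xs f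
  ∑ℤ-ℕ f [] = refl
  ∑ℤ-ℕ f (x ∷ xs) = cong (+ f x +ℤ_) (∑ℤ-ℕ f xs)

  ∑ℤ-zero : (xs : List A) → ∑ℤ xs (λ _ → + 0) ≡ + 0
  ∑ℤ-zero [] = refl
  ∑ℤ-zero (x ∷ xs) = trans (ℤ.+-identityˡ (∑ℤ xs (λ _ → + 0))) (∑ℤ-zero xs)

  ∑ℤ-+ : (f g : A → ℤ) (xs : List A) → ∑ℤ xs (λ x → f x +ℤ g x) ≡ ∑ℤ xs f +ℤ ∑ℤ xs g
  ∑ℤ-+ f g [] = refl
  ∑ℤ-+ f g (x ∷ xs) = trans (cong ((f x +ℤ g x) +ℤ_) (∑ℤ-+ f g xs)) (ℤ+-interchange (f x) (g x) (∑ℤ xs f) (∑ℤ xs g))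

  ∑ℤ-*ˡ : (c : ℤ) (f : A → ℤ) (xs : List A) → ∑ℤ xs (λ x → c *ℤ f x) ≡ c *ℤ ∑ℤ xs f
  ∑ℤ-*ˡ c f [] = sym (ℤ.*-zeroʳ c)
  ∑ℤ-*ˡ c f (x ∷ xs) = trans (cong (c *ℤ f x +ℤ_) (∑ℤ-*ˡ c f xs)) (sym (ℤ.*-distribˡ-+ c (f x) (∑ℤ xs f)))

  ∑ℤ-*ʳ : (c : ℤ) (f : A → ℤ) (xs : List A) → ∑ℤ xs (λ x → f x *ℤ c) ≡ ∑ℤ xs f *ℤ c
  ∑ℤ-*ʳ c f xs = trans (∑ℤ-cong xs (λ x → ℤ.*-comm (f x) c)) (trans (∑ℤ-*ˡ c f xs) (ℤ.*-comm c (∑ℤ xs f)))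

  ∑ℤ-++ : (f : A → ℤ) (xs ys : List A) → ∑ℤ (xs ++ ys) f ≡ ∑ℤ xs f +ℤ ∑ℤ ys f
  ∑ℤ-++ f [] ys = sym (ℤ.+-identityˡ (∑ℤ ys f))
  ∑ℤ-++ f (x ∷ xs) ys = trans (cong (f x +ℤ_) (∑ℤ-++ f xs ys)) (sym (ℤ.+-assoc (f x) (∑ℤ xs f) (∑ℤ ys f)))

module _ {A B : Set} where

  ∑ℤ-map : (f : A → B) (g : B → ℤ) (xs : List A) → ∑ℤ (map f xs) g ≡ ∑ℤ xs (g ∘ f)
  ∑ℤ-map f g [] = refl
  ∑ℤ-map f g (x ∷ xs) = cong (g (f x) +ℤ_) (∑ℤ-map f g xs)

  ∑ℤ-swap : (xs : List A) (ys : List B) (f : A → B → ℤ) → ∑ℤ xs (λ x → ∑ℤ ys (f x)) ≡ ∑ℤ ys (λ y → ∑ℤ xs (λ x → f x y))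
  ∑ℤ-swap [] ys f = sym (∑ℤ-zero ys)
  ∑ℤ-swap (x ∷ xs) ys f = trans (cong (∑ℤ ys (f x) +ℤ_) (∑ℤ-swap xs ys f)) (sym (∑ℤ-+ (f x) (λ y → ∑ℤ xs (λ x → f x y)) ys))

-- Inclusion–exclusion

sign : {A : Set} → List A → ℤ
sign S = (- (+ 1)) ^ (length S ∸ 1)

data NonEmpty {A : Set} : List A → Set where
  _∷_ : ∀ x xs → NonEmpty (x ∷ xs)

module _ {A : Set} where

  nonemptySubs-All : {P : A → Set} (xs : List A) → All P xs → All (All P) (nonemptySubs xs)
  nonemptySubs-All [] [] = []
  nonemptySubs-All (x ∷ xs) (px ∷ pxs) =
    All.++⁺ (All.map⁺ ((px ∷ []) ∷ All.map (px ∷_) (nonemptySubs-All xs pxs))) (nonemptySubs-All xs pxs)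

  nonemptySubs-NonEmpty : (xs : List A) → All NonEmpty (nonemptySubs xs)
  nonemptySubs-NonEmpty [] = []
  nonemptySubs-NonEmpty (x ∷ xs) =
    All.++⁺ (All.map⁺ ((x ∷ []) ∷ All.tabulate (λ {S} _ → x ∷ S))) (nonemptySubs-NonEmpty xs)

  -- Splitting the nonempty subsets of x ∷ xs by whether they contain x; adding x flips the sign.
  inclusion-exclusion : (p : A → Bool) (xs : List A) →
                        ∑ℤ (nonemptySubs xs) (λ S → sign S *ℤ + ⟦ all p S ⟧) ≡ + ⟦ any p xs ⟧
  inclusion-exclusion p [] = refl
  inclusion-exclusion p (x ∷ xs) = begin
    ∑ℤ (map (x ∷_) ([] ∷ nonemptySubs xs) ++ nonemptySubs xs) term
      ≡⟨ ∑ℤ-++ term (map (x ∷_) ([] ∷ nonemptySubs xs)) (nonemptySubs xs) ⟩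
    ∑ℤ (map (x ∷_) ([] ∷ nonemptySubs xs)) term +ℤ rest
      ≡⟨ cong (_+ℤ rest) (∑ℤ-map (x ∷_) term ([] ∷ nonemptySubs xs)) ⟩
    (term (x ∷ []) +ℤ ∑ℤ (nonemptySubs xs) (λ S → term (x ∷ S))) +ℤ rest
      ≡⟨ cong (λ z → (term (x ∷ []) +ℤ z) +ℤ rest) (∑ℤ-congᴬ (nonemptySubs xs) (nonemptySubs-NonEmpty xs) term-∷) ⟩
    (term (x ∷ []) +ℤ ∑ℤ (nonemptySubs xs) (λ S → - + ⟦ p x ⟧ *ℤ term S)) +ℤ rest
      ≡⟨ cong (λ z → (term (x ∷ []) +ℤ z) +ℤ rest) (∑ℤ-*ˡ (- + ⟦ p x ⟧) term (nonemptySubs xs)) ⟩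
    (term (x ∷ []) +ℤ - + ⟦ p x ⟧ *ℤ rest) +ℤ rest
      ≡⟨ cong (λ z → (term (x ∷ []) +ℤ - + ⟦ p x ⟧ *ℤ z) +ℤ z) (inclusion-exclusion p xs) ⟩
    (term (x ∷ []) +ℤ - + ⟦ p x ⟧ *ℤ + ⟦ any p xs ⟧) +ℤ + ⟦ any p xs ⟧
      ≡⟨ by-cases (p x) (any p xs) ⟩
    + ⟦ p x ∨ any p xs ⟧ ∎
    where
    open ≡-Reasoning
    term : List A → ℤ
    term S = sign S *ℤ + ⟦ all p S ⟧
    rest : ℤ
    rest = ∑ℤ (nonemptySubs xs) term
    term-∷ : ∀ S → NonEmpty S → term (x ∷ S) ≡ - + ⟦ p x ⟧ *ℤ term S
    term-∷ S (y ∷ S′) = begin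
      (- + 1 *ℤ sign S) *ℤ + ⟦ p x ∧ all p S ⟧     ≡⟨ cong (λ z → (- + 1 *ℤ sign S) *ℤ + z) (⟦∧⟧ (p x) (all p S)) ⟩
      (- + 1 *ℤ sign S) *ℤ + (⟦ p x ⟧ * ⟦ all p S ⟧) ≡⟨ cong ((- + 1 *ℤ sign S) *ℤ_) (ℤ.pos-* ⟦ p x ⟧ ⟦ all p S ⟧) ⟩
      (- + 1 *ℤ sign S) *ℤ (+ ⟦ p x ⟧ *ℤ + ⟦ all p S ⟧) ≡⟨ regroup (sign S) (+ ⟦ p x ⟧) (+ ⟦ all p S ⟧) ⟩
      - + ⟦ p x ⟧ *ℤ term S ∎
      where
      regroup : ∀ a b c → (- + 1 *ℤ a) *ℤ (b *ℤ c) ≡ - b *ℤ (a *ℤ c)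
      regroup = solve-∀
    by-cases : ∀ a b → (sign (x ∷ []) *ℤ + ⟦ a ∧ true ⟧ +ℤ - + ⟦ a ⟧ *ℤ + ⟦ b ⟧) +ℤ + ⟦ b ⟧ ≡ + ⟦ a ∨ b ⟧
    by-cases true true = refl
    by-cases true false = refl
    by-cases false true = refl
    by-cases false false = refl

record Enumeration (A : Set) : Set where
  field
    elements    : List A
    _≈_         : A → A → Bool
    ≈-sym       : ∀ {a b} → a ≈ b ≡ true → b ≈ a ≡ true
    ≈-trans     : ∀ {a b c} → a ≈ b ≡ true → b ≈ c ≡ true → a ≈ c ≡ true
    exactlyOnce : ∀ a → ∑ elements (λ x → ⟦ a ≈ x ⟧) ≡ 1

module _ {A : Set} (E : Enumeration A) where
  open Enumeration E

  ∑-δ : (f : A → ℕ) → (∀ {x y} → x ≈ y ≡ true → f x ≡ f y) → ∀ a → ∑ elements (λ x → ⟦ a ≈ x ⟧ * f x) ≡ f a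
  ∑-δ f f-resp a = begin
    ∑ elements (λ x → ⟦ a ≈ x ⟧ * f x) ≡⟨ ∑-cong elements δ-comm ⟩
    ∑ elements (λ x → f a * ⟦ a ≈ x ⟧) ≡⟨ ∑-*ˡ (f a) (λ x → ⟦ a ≈ x ⟧) elements ⟩
    f a * ∑ elements (λ x → ⟦ a ≈ x ⟧) ≡⟨ cong (f a *_) (exactlyOnce a) ⟩
    f a * 1                            ≡⟨ ℕ.*-identityʳ (f a) ⟩
    f a                                ∎
    where
    open ≡-Reasoning
    δ-comm : ∀ x → ⟦ a ≈ x ⟧ * f x ≡ f a * ⟦ a ≈ x ⟧
    δ-comm x with a ≈ x in a≈x
    ... | true = trans (ℕ.+-identityʳ (f x)) (trans (sym (f-resp a≈x)) (sym (ℕ.*-identityʳ (f a))))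
    ... | false = sym (ℕ.*-zeroʳ (f a))

record SubsetBijection {A B : Set} (EA : Enumeration A) (EB : Enumeration B)
                       (p : A → Bool) (q : B → Bool) : Set where
  open Enumeration EA using () renaming (_≈_ to _≈ᴬ_)
  open Enumeration EB using () renaming (_≈_ to _≈ᴮ_)
  field
    to        : A → B
    from      : B → A
    to-∈      : ∀ x → p x ≡ true → q (to x) ≡ true
    from-∈    : ∀ y → q y ≡ true → p (from y) ≡ true
    from-to   : ∀ x → p x ≡ true → from (to x) ≈ᴬ x ≡ true
    to-from   : ∀ y → q y ≡ true → to (from y) ≈ᴮ y ≡ true
    p-resp    : ∀ {x x′} → x ≈ᴬ x′ ≡ true → p x ≡ true → p x′ ≡ true
    q-resp    : ∀ {y y′} → y ≈ᴮ y′ ≡ true → q y ≡ true → q y′ ≡ true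
    to-cong   : ∀ {x x′} → x ≈ᴬ x′ ≡ true → to x ≈ᴮ to x′ ≡ true
    from-cong : ∀ {y y′} → y ≈ᴮ y′ ≡ true → from y ≈ᴬ from y′ ≡ true

module _ {A B : Set} {EA : Enumeration A} {EB : Enumeration B} {p : A → Bool} {q : B → Bool} where
  open Enumeration EA using () renaming (elements to xs; _≈_ to _≈ᴬ_; ≈-sym to ≈ᴬ-sym; ≈-trans to ≈ᴬ-trans; exactlyOnce to onceᴬ)
  open Enumeration EB using () renaming (elements to ys; _≈_ to _≈ᴮ_; ≈-sym to ≈ᴮ-sym; ≈-trans to ≈ᴮ-trans; exactlyOnce to onceᴮ)

  -- Double counting of the pairs (x , y) with p x and to x ≈ y.
  count-bijection : SubsetBijection EA EB p q → ∑ xs (λ x → ⟦ p x ⟧) ≡ ∑ ys (λ y → ⟦ q y ⟧)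
  count-bijection bij = begin
    ∑ xs (λ x → ⟦ p x ⟧)
      ≡⟨ ∑-cong xs (λ x → sym (trans (cong (⟦ p x ⟧ *_) (onceᴮ (to x))) (ℕ.*-identityʳ _))) ⟩
    ∑ xs (λ x → ⟦ p x ⟧ * ∑ ys (λ y → ⟦ to x ≈ᴮ y ⟧))
      ≡⟨ ∑-cong xs (λ x → sym (∑-*ˡ ⟦ p x ⟧ (λ y → ⟦ to x ≈ᴮ y ⟧) ys)) ⟩
    ∑ xs (λ x → ∑ ys (λ y → pair x y))
      ≡⟨ ∑-swap xs ys pair ⟩
    ∑ ys (λ y → ∑ xs (λ x → pair x y))
      ≡⟨ ∑-cong ys fibre ⟩
    ∑ ys (λ y → ⟦ q y ⟧) ∎
    where
    open ≡-Reasoning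
    open SubsetBijection bij
    pair : A → B → ℕ
    pair x y = ⟦ p x ⟧ * ⟦ to x ≈ᴮ y ⟧
    fibre : ∀ y → ∑ xs (λ x → pair x y) ≡ ⟦ q y ⟧
    fibre y with q y in qy
    ... | true = trans (∑-cong xs pair≡δ) (onceᴬ (from y))
      where
      pair≡δ : ∀ x → pair x y ≡ ⟦ from y ≈ᴬ x ⟧
      pair≡δ x = trans (sym (⟦∧⟧ (p x) (to x ≈ᴮ y))) (cong ⟦_⟧ (true-ext
        (λ e → ≈ᴬ-trans (from-cong (≈ᴮ-sym (∧-elimʳ {p x} e))) (from-to x (∧-elimˡ e)))
        (λ e → ∧-intro (p-resp e (from-∈ y qy)) (≈ᴮ-trans (to-cong (≈ᴬ-sym e)) (to-from y qy)))))
    ... | false = ∑-zero xs pair≡0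
      where
      pair≡0 : ∀ x → pair x y ≡ 0
      pair≡0 x with p x in px | to x ≈ᴮ y in x↦y
      ... | true | true = ⊥-elim (false≢true qy (q-resp x↦y (to-∈ x px)))
      ... | true | false = refl
      ... | false | _ = refl

module _ {A : Set} (_≟_ : DecidableEquality A) where

  decEnumeration : (xs : List A) → (∀ a → ∑ xs (λ x → ⟦ ⌊ a ≟ x ⌋ ⟧) ≡ 1) → Enumeration A
  decEnumeration xs once = record
    { elements = xs ; _≈_ = λ a b → ⌊ a ≟ b ⌋
    ; ≈-sym = ≡⇒≟-true _≟_ ∘ sym ∘ ≟-true⇒≡ _≟_
    ; ≈-trans = λ e f → ≡⇒≟-true _≟_ (trans (≟-true⇒≡ _≟_ e) (≟-true⇒≡ _≟_ f))
    ; exactlyOnce = once }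

finEnumeration : (N : ℕ) → Enumeration (Fin N)
finEnumeration N = decEnumeration Fin._≟_ (allFin N) ∑-allFin-δ

boolEnumeration : Enumeration Bool
boolEnumeration = decEnumeration Bool._≟_ (true ∷ false ∷ []) λ { true → refl ; false → refl }

-- Functions have no decidable equality, so they are enumerated up to pointwise equivalence.
module _ {A : Set} (E : Enumeration A) where
  open Enumeration E

  pointwise : {m : ℕ} → (Fin m → A) → (Fin m → A) → Bool
  pointwise {zero} f g = true
  pointwise {suc m} f g = (f zero ≈ g zero) ∧ pointwise (f ∘ suc) (g ∘ suc)

  pointwise-elim : {m : ℕ} {f g : Fin m → A} → pointwise f g ≡ true → ∀ i → f i ≈ g i ≡ true
  pointwise-elim {suc m} e zero = ∧-elimˡ e
  pointwise-elim {suc m} {f} {g} e (suc i) = pointwise-elim (∧-elimʳ {f zero ≈ g zero} e) i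

  pointwise-intro : {m : ℕ} {f g : Fin m → A} → (∀ i → f i ≈ g i ≡ true) → pointwise f g ≡ true
  pointwise-intro {zero} _ = refl
  pointwise-intro {suc m} h = ∧-intro (h zero) (pointwise-intro (h ∘ suc))

  allFuns-exactlyOnce : (m : ℕ) (f : Fin m → A) → ∑ (allFuns m elements) (λ g → ⟦ pointwise f g ⟧) ≡ 1
  allFuns-exactlyOnce zero f = refl
  allFuns-exactlyOnce (suc m) f = begin
    ∑ (allFuns (suc m) elements) (λ g → ⟦ pointwise f g ⟧)
      ≡⟨ ∑-concatMap (λ a → map (a VF.∷_) (allFuns m elements)) (λ g → ⟦ pointwise f g ⟧) elements ⟩
    ∑ elements (λ a → ∑ (map (a VF.∷_) (allFuns m elements)) (λ g → ⟦ pointwise f g ⟧))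
      ≡⟨ ∑-cong elements (λ a → ∑-map (a VF.∷_) (λ g → ⟦ pointwise f g ⟧) (allFuns m elements)) ⟩
    ∑ elements (λ a → ∑ (allFuns m elements) (λ g → ⟦ (f zero ≈ a) ∧ pointwise (f ∘ suc) g ⟧))
      ≡⟨ ∑-cong elements (λ a → trans (∑-cong (allFuns m elements) (λ g → ⟦∧⟧ (f zero ≈ a) (pointwise (f ∘ suc) g)))
                                      (∑-*ˡ ⟦ f zero ≈ a ⟧ (λ g → ⟦ pointwise (f ∘ suc) g ⟧) (allFuns m elements))) ⟩
    ∑ elements (λ a → ⟦ f zero ≈ a ⟧ * ∑ (allFuns m elements) (λ g → ⟦ pointwise (f ∘ suc) g ⟧))
      ≡⟨ ∑-cong elements (λ a → trans (cong (⟦ f zero ≈ a ⟧ *_) (allFuns-exactlyOnce m (f ∘ suc))) (ℕ.*-identityʳ _)) ⟩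
    ∑ elements (λ a → ⟦ f zero ≈ a ⟧)
      ≡⟨ exactlyOnce (f zero) ⟩
    1 ∎
    where open ≡-Reasoning

  funEnumeration : (m : ℕ) → Enumeration (Fin m → A)
  funEnumeration m = record
    { elements = allFuns m elements ; _≈_ = pointwise
    ; ≈-sym = λ {f} {g} e → pointwise-intro {m} {g} {f} (≈-sym ∘ pointwise-elim {m} {f} {g} e)
    ; ≈-trans = λ {f} {g} {h} e e′ →
        pointwise-intro {m} {f} {h} (λ i → ≈-trans (pointwise-elim {m} {f} {g} e i) (pointwise-elim {m} {g} {h} e′ i))
    ; exactlyOnce = allFuns-exactlyOnce m }

colourings : (m N : ℕ) → Enumeration (Fin m → Fin N)
colourings m N = funEnumeration (finEnumeration N) m

≈ᶜ⇒≗ : {m N : ℕ} {f g : Fin m → Fin N} → Enumeration._≈_ (colourings m N) f g ≡ true → ∀ i → f i ≡ g i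
≈ᶜ⇒≗ {N = N} e i = ==⇒≡ (pointwise-elim (finEnumeration N) e i)

≗⇒≈ᶜ : {m N : ℕ} {f g : Fin m → Fin N} → (∀ i → f i ≡ g i) → Enumeration._≈_ (colourings m N) f g ≡ true
≗⇒≈ᶜ {N = N} h = pointwise-intro (finEnumeration N) (≡⇒== ∘ h)

relations : (n : ℕ) → Enumeration (BRel n)
relations n = funEnumeration (funEnumeration boolEnumeration n) n

_≈ᴿ_ : {n : ℕ} → BRel n → BRel n → Bool
_≈ᴿ_ {n} = Enumeration._≈_ (relations n)

≈ᴿ⇒≗ : {n : ℕ} {R T : BRel n} → R ≈ᴿ T ≡ true → ∀ u v → R u v ≡ T u v
≈ᴿ⇒≗ {n} e u v = ≟-true⇒≡ Bool._≟_ (pointwise-elim boolEnumeration (pointwise-elim (funEnumeration boolEnumeration n) e u) v)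

≗⇒≈ᴿ : {n : ℕ} {R T : BRel n} → (∀ u v → R u v ≡ T u v) → R ≈ᴿ T ≡ true
≗⇒≈ᴿ {n} h = pointwise-intro (funEnumeration boolEnumeration n)
  (λ u → pointwise-intro boolEnumeration (λ v → ≡⇒≟-true Bool._≟_ (h u v)))

_⊆ᴿ_ : {n : ℕ} → BRel n → BRel n → Set
R ⊆ᴿ T = ∀ u v → R u v ≡ true → T u v ≡ true

_⊑_ : {n : ℕ} → BRel n → BRel n → Bool
_⊑_ {n} R T = all (λ u → all (λ v → R u v ⇒ᵇ T u v) (allFin n)) (allFin n)

⊑⇒⊆ᴿ : {n : ℕ} (R T : BRel n) → R ⊑ T ≡ true → R ⊆ᴿ T
⊑⇒⊆ᴿ {n} R T e u v =
  ⇒ᵇ-elim (allFin-elim (λ v → R u v ⇒ᵇ T u v) (allFin-elim (λ u → all (λ v → R u v ⇒ᵇ T u v) (allFin n)) e u) v)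

⊆ᴿ⇒⊑ : {n : ℕ} (R T : BRel n) → R ⊆ᴿ T → R ⊑ T ≡ true
⊆ᴿ⇒⊑ {n} R T h = allFin-intro _ (λ u → allFin-intro (λ v → R u v ⇒ᵇ T u v) (λ v → ⇒ᵇ-intro (h u v)))

⊑-meet : {n : ℕ} (R : BRel n) (Ms : List (BRel n)) → R ⊑ meet Ms ≡ all (R ⊑_) Ms
⊑-meet R [] = ⊆ᴿ⇒⊑ R (meet []) (λ _ _ _ → refl)
⊑-meet R (M ∷ Ms) = trans (true-ext split join) (cong (R ⊑ M ∧_) (⊑-meet R Ms))
  where
  split : R ⊑ meet (M ∷ Ms) ≡ true → (R ⊑ M) ∧ (R ⊑ meet Ms) ≡ true
  split e = ∧-intro (⊆ᴿ⇒⊑ R M (λ u v r → ∧-elimˡ (⊑⇒⊆ᴿ R (meet (M ∷ Ms)) e u v r)))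
                    (⊆ᴿ⇒⊑ R (meet Ms) (λ u v r → ∧-elimʳ {M u v} (⊑⇒⊆ᴿ R (meet (M ∷ Ms)) e u v r)))
  join : (R ⊑ M) ∧ (R ⊑ meet Ms) ≡ true → R ⊑ meet (M ∷ Ms) ≡ true
  join e = ⊆ᴿ⇒⊑ R (meet (M ∷ Ms))
    (λ u v r → ∧-intro (⊑⇒⊆ᴿ R M (∧-elimˡ e) u v r) (⊑⇒⊆ᴿ R (meet Ms) (∧-elimʳ {R ⊑ M} e) u v r))

record IsEquiv {n : ℕ} (R : BRel n) : Set where
  field
    reflexive  : ∀ u → R u u ≡ true
    symmetric  : ∀ {u v} → R u v ≡ true → R v u ≡ true
    transitive : ∀ {u v w} → R u v ≡ true → R v w ≡ true → R u w ≡ true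

isEquivᵇ⇒IsEquiv : {n : ℕ} (R : BRel n) → isEquivᵇ R ≡ true → IsEquiv R
isEquivᵇ⇒IsEquiv {n} R e = record
  { reflexive = allFin-elim (λ u → R u u) (∧-elimˡ e)
  ; symmetric = λ {u} {v} → ⇒ᵇ-elim (allFin-elim (λ v → R u v ⇒ᵇ R v u) (allFin-elim symᵘ (∧-elimˡ sym∧trans) u) v)
  ; transitive = λ {u} {v} {w} r s → ⇒ᵇ-elim (allFin-elim (λ w → (R u v ∧ R v w) ⇒ᵇ R u w)
      (allFin-elim (transᵘᵛ u) (allFin-elim (λ u → all (transᵘᵛ u) (allFin n)) (∧-elimʳ {all symᵘ (allFin n)} sym∧trans) u) v) w)
      (∧-intro r s) }
  where
  symᵘ : Fin n → Bool
  symᵘ u = all (λ v → R u v ⇒ᵇ R v u) (allFin n)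
  transᵘᵛ : Fin n → Fin n → Bool
  transᵘᵛ u v = all (λ w → (R u v ∧ R v w) ⇒ᵇ R u w) (allFin n)
  sym∧trans = ∧-elimʳ {all (λ u → R u u) (allFin n)} e

IsEquiv⇒isEquivᵇ : {n : ℕ} (R : BRel n) → IsEquiv R → isEquivᵇ R ≡ true
IsEquiv⇒isEquivᵇ {n} R I = ∧-intro (allFin-intro (λ u → R u u) reflexive)
  (∧-intro (allFin-intro _ (λ u → allFin-intro (λ v → R u v ⇒ᵇ R v u) (λ v → ⇒ᵇ-intro symmetric)))
           (allFin-intro _ (λ u → allFin-intro _ (λ v → allFin-intro (λ w → (R u v ∧ R v w) ⇒ᵇ R u w) (λ w →
              ⇒ᵇ-intro (λ e → transitive (∧-elimˡ e) (∧-elimʳ {R u v} e)))))))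
  where open IsEquiv I

IsEquiv-resp : {n : ℕ} {R T : BRel n} → (∀ u v → R u v ≡ T u v) → IsEquiv R → IsEquiv T
IsEquiv-resp R≗T I = record
  { reflexive = λ u → trans (sym (R≗T u u)) (reflexive u)
  ; symmetric = λ {u} {v} r → trans (sym (R≗T v u)) (symmetric (trans (R≗T u v) r))
  ; transitive = λ {u} {v} {w} r s → trans (sym (R≗T u w)) (transitive (trans (R≗T u v) r) (trans (R≗T v w) s)) }
  where open IsEquiv I

isEquivᵇ-resp : {n : ℕ} {R T : BRel n} → R ≈ᴿ T ≡ true → isEquivᵇ R ≡ isEquivᵇ T
isEquivᵇ-resp {R = R} {T} e = true-ext
  (λ r → IsEquiv⇒isEquivᵇ T (IsEquiv-resp (≈ᴿ⇒≗ e) (isEquivᵇ⇒IsEquiv R r)))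
  (λ t → IsEquiv⇒isEquivᵇ R (IsEquiv-resp (λ u v → sym (≈ᴿ⇒≗ e u v)) (isEquivᵇ⇒IsEquiv T t)))

meet-IsEquiv : {n : ℕ} (Ms : List (BRel n)) → All (λ M → isEquivᵇ M ≡ true) Ms → IsEquiv (meet Ms)
meet-IsEquiv [] [] = record { reflexive = λ _ → refl ; symmetric = λ _ → refl ; transitive = λ _ _ → refl }
meet-IsEquiv (M ∷ Ms) (e ∷ es) = record
  { reflexive = λ u → ∧-intro (I.reflexive u) (J.reflexive u)
  ; symmetric = λ {u} {v} r → ∧-intro (I.symmetric (∧-elimˡ r)) (J.symmetric (∧-elimʳ {M u v} r))
  ; transitive = λ {u} {v} {w} r s →
      ∧-intro (I.transitive (∧-elimˡ r) (∧-elimˡ s)) (J.transitive (∧-elimʳ {M u v} r) (∧-elimʳ {M v w} s)) }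
  where
  module I = IsEquiv (isEquivᵇ⇒IsEquiv M e)
  module J = IsEquiv (meet-IsEquiv Ms es)

setPartitions-isEquivᵇ : (n : ℕ) → All (λ π → isEquivᵇ π ≡ true) (setPartitions n)
setPartitions-isEquivᵇ n = All.tabulate (λ π∈ → proj₂ (∈-filterᵇ⁻ isEquivᵇ {allFuns n (allFuns n (true ∷ false ∷ []))} π∈))

kernel : {m N : ℕ} → (Fin m → Fin N) → BRel m
kernel κ u v = κ u == κ v

kernel-isEquivᵇ : {m N : ℕ} (κ : Fin m → Fin N) → isEquivᵇ (kernel κ) ≡ true
kernel-isEquivᵇ κ = IsEquiv⇒isEquivᵇ (kernel κ)
  (record { reflexive = λ u → ==-refl (κ u) ; symmetric = ==-sym ; transitive = ==-trans })

eP-resp : (G : Graph) {R T : BRel (n G)} → R ≈ᴿ T ≡ true → eP G R ≡ eP G T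
eP-resp G e = countᵇ-cong (edges G) (λ { (a , b) → ≈ᴿ⇒≗ e a b })

eP-mono : (G : Graph) {R T : BRel (n G)} → R ⊆ᴿ T → eP G R ≤ eP G T
eP-mono G R⊆T = countᵇ-mono (edges G) (λ { (a , b) → R⊆T a b })

-- Coarsening to a maximal partition

module Coarsening (G : Graph) (j : ℕ) where

  unrelatedPairs : BRel (n G) → ℕ
  unrelatedPairs ρ = ∑ (allFin (n G)) (λ u → ∑ (allFin (n G)) (λ v → ⟦ not (ρ u v) ⟧))

  edgeBetweenAllBlocks-resp : {R T : BRel (n G)} → (∀ u v → R u v ≡ T u v) →
                              edgeBetweenAllBlocks G R ≡ edgeBetweenAllBlocks G T
  edgeBetweenAllBlocks-resp R≗T = all-cong _ _ (allFin (n G)) (λ u → all-cong _ _ (allFin (n G)) (λ v →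
    cong₂ _⇒ᵇ_ (cong not (R≗T u v)) (any-cong _ _ (edges G)
      (λ { (a , b) → cong₂ _∨_ (cong₂ _∧_ (R≗T a u) (R≗T b v)) (cong₂ _∧_ (R≗T a v) (R≗T b u)) }))))

  RefinesMaximal : BRel (n G) → Set
  RefinesMaximal ρ = Σ (BRel (n G)) λ M → M ∈ maximalUpTo G j × ρ ⊆ᴿ M

  -- The listed copy of ρ (equal to it pointwise) is itself maximal.
  edgeBetweenAllBlocks⇒RefinesMaximal : (ρ : BRel (n G)) → IsEquiv ρ → edgeBetweenAllBlocks G ρ ≡ true →
                                        eP G ρ ≤ j → RefinesMaximal ρ
  edgeBetweenAllBlocks⇒RefinesMaximal ρ ρ-equiv ρ-edges ρ≤j
    with ∑-witness (ρ ≈ᴿ_) (Enumeration.elements (relations (n G))) (Enumeration.exactlyOnce (relations (n G)) ρ)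
  ... | M , M∈ , ρ≈M = M , M∈maximal , (λ a b r → trans (sym (≈ᴿ⇒≗ ρ≈M a b)) r)
    where
    eM≡eρ : eP G M ≡ eP G ρ
    eM≡eρ = sym (eP-resp G ρ≈M)
    M-maximal : isMaximal G (eP G M) M ≡ true
    M-maximal = ∧-intro (≡⇒≡ᵇ {eP G M} refl) (trans (sym (edgeBetweenAllBlocks-resp (≈ᴿ⇒≗ ρ≈M))) ρ-edges)
    M∈partitions : M ∈ setPartitions (n G)
    M∈partitions = ∈-filterᵇ⁺ isEquivᵇ M∈ (IsEquiv⇒isEquivᵇ M (IsEquiv-resp (≈ᴿ⇒≗ ρ≈M) ρ-equiv))
    M∈maximal : M ∈ maximalUpTo G j
    M∈maximal = ∈-filterᵇ⁺ _ M∈partitions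
      (any-intro (λ i → isMaximal G i M) (upTo (suc j)) (∈-upTo⁺ (s≤s (subst (_≤ j) (sym eM≡eρ) ρ≤j))) M-maximal)

  module Merge (ρ : BRel (n G)) (ρ-equiv : IsEquiv ρ) (u v : Fin (n G)) where
    open IsEquiv ρ-equiv

    inMerged : Fin (n G) → Bool
    inMerged x = ρ x u ∨ ρ x v

    merged : BRel (n G)
    merged a b = ρ a b ∨ (inMerged a ∧ inMerged b)

    inMerged-resp : ∀ {a b} → ρ a b ≡ true → inMerged b ≡ true → inMerged a ≡ true
    inMerged-resp {a} {b} r w with ∨-elim {ρ b u} w
    ... | inj₁ bu = ∨-introˡ (transitive r bu)
    ... | inj₂ bv = ∨-introʳ {ρ a u} (transitive r bv)

    ρ⊆merged : ρ ⊆ᴿ merged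
    ρ⊆merged a b = ∨-introˡ

    merged-IsEquiv : IsEquiv merged
    merged-IsEquiv = record
      { reflexive = λ a → ∨-introˡ (reflexive a)
      ; symmetric = λ {a} {b} → merged-sym {a} {b}
      ; transitive = λ {a} {b} {c} → merged-trans {a} {b} {c} }
      where
      merged-sym : ∀ {a b} → merged a b ≡ true → merged b a ≡ true
      merged-sym {a} {b} m with ∨-elim {ρ a b} m
      ... | inj₁ r = ∨-introˡ (symmetric r)
      ... | inj₂ w = ∨-introʳ {ρ b a} (∧-intro (∧-elimʳ {inMerged a} w) (∧-elimˡ w))
      merged-trans : ∀ {a b c} → merged a b ≡ true → merged b c ≡ true → merged a c ≡ true
      merged-trans {a} {b} {c} m m′ with ∨-elim {ρ a b} m | ∨-elim {ρ b c} m′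
      ... | inj₁ r | inj₁ s = ∨-introˡ (transitive r s)
      ... | inj₁ r | inj₂ w = ∨-introʳ {ρ a c} (∧-intro (inMerged-resp r (∧-elimˡ w)) (∧-elimʳ {inMerged b} w))
      ... | inj₂ w | inj₁ s = ∨-introʳ {ρ a c} (∧-intro (∧-elimˡ w) (inMerged-resp (symmetric s) (∧-elimʳ {inMerged a} w)))
      ... | inj₂ w | inj₂ w′ = ∨-introʳ {ρ a c} (∧-intro (∧-elimˡ w) (∧-elimʳ {inMerged b} w′))

    joins : Fin (n G) × Fin (n G) → Bool
    joins (a , b) = (ρ a u ∧ ρ b v) ∨ (ρ a v ∧ ρ b u)

    eP-merged : any joins (edges G) ≡ false → eP G merged ≡ eP G ρ
    eP-merged no-edge = countᵇ-cong∈ (edges G) (λ { {a , b} e∈ → true-ext (unmerge e∈) (ρ⊆merged a b) })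
      where
      unmerge : ∀ {a b} → (a , b) ∈ edges G → merged a b ≡ true → ρ a b ≡ true
      unmerge {a} {b} e∈ m with ∨-elim {ρ a b} m
      ... | inj₁ r = r
      ... | inj₂ w with ∨-elim {ρ a u} (∧-elimˡ w) | ∨-elim {ρ b u} (∧-elimʳ {inMerged a} w)
      ...   | inj₁ au | inj₁ bu = transitive au (symmetric bu)
      ...   | inj₁ au | inj₂ bv = ⊥-elim (false≢true no-edge (any-intro joins (edges G) e∈ (∨-introˡ (∧-intro au bv))))
      ...   | inj₂ av | inj₁ bu = ⊥-elim (false≢true no-edge (any-intro joins (edges G) e∈ (∨-introʳ {ρ a u ∧ ρ b v} (∧-intro av bu))))
      ...   | inj₂ av | inj₂ bv = transitive av (symmetric bv)

    unrelatedPairs-merged : ρ u v ≡ false → unrelatedPairs merged < unrelatedPairs ρ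
    unrelatedPairs-merged ρuv = ∑-mono-< (allFin (n G)) (λ a → ∑-mono (allFin (n G)) (λ b → fewer a b)) (∈-allFin u)
                                  (∑-mono-< (allFin (n G)) (fewer u) (∈-allFin v) strictly)
      where
      fewer : ∀ a b → ⟦ not (merged a b) ⟧ ≤ ⟦ not (ρ a b) ⟧
      fewer a b = ⟦⟧-mono (false⇒not-true ∘ ¬true⇒false ∘ λ ¬m r → false≢true (not-true⇒false ¬m) (∨-introˡ r))
      strictly : ⟦ not (merged u v) ⟧ < ⟦ not (ρ u v) ⟧
      strictly = ⟦not⟧-< merged-uv ρuv
        where
        merged-uv : merged u v ≡ true
        merged-uv = ∨-introʳ {ρ u v} (∧-intro {inMerged u} {inMerged v} (∨-introˡ (reflexive u)) (∨-introʳ {ρ v u} (reflexive v)))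
        ⟦not⟧-< : ∀ {x y} → x ≡ true → y ≡ false → ⟦ not x ⟧ < ⟦ not y ⟧
        ⟦not⟧-< refl refl = s≤s z≤n

    RefinesMaximal-merged : RefinesMaximal merged → RefinesMaximal ρ
    RefinesMaximal-merged (M , M∈ , merged⊆M) = M , M∈ , (λ a b → merged⊆M a b ∘ ρ⊆merged a b)

  coarsen : (fuel : ℕ) (ρ : BRel (n G)) → unrelatedPairs ρ < fuel → IsEquiv ρ → eP G ρ ≤ j → RefinesMaximal ρ
  coarsen (suc fuel) ρ lt ρ-equiv ρ≤j with edgeBetweenAllBlocks G ρ in ρ-edges
  ... | true = edgeBetweenAllBlocks⇒RefinesMaximal ρ ρ-equiv ρ-edges ρ≤j
  ... | false with all-false _ (allFin (n G)) ρ-edges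
  ...   | u , _ , no-v with all-false _ (allFin (n G)) no-v
  ...     | v , _ , no-edge with ⇒ᵇ-false {not (ρ u v)} no-edge
  ...       | ¬ρuv , no-join = RefinesMaximal-merged (coarsen fuel merged
                (ℕ.≤-trans (unrelatedPairs-merged (not-true⇒false ¬ρuv)) (ℕ.≤-pred lt))
                merged-IsEquiv (subst (_≤ j) (sym (eP-merged no-join)) ρ≤j))
    where open Merge ρ ρ-equiv u v

  ∈maximalUpTo⁻ : ∀ {M} → M ∈ maximalUpTo G j → Σ ℕ λ i → i ∈ upTo (suc j) × isMaximal G i M ≡ true
  ∈maximalUpTo⁻ {M} M∈ = any-elim (λ i → isMaximal G i M) (upTo (suc j))
    (proj₂ (∈-filterᵇ⁻ (λ π → any (λ i → isMaximal G i π) (upTo (suc j))) {setPartitions (n G)} M∈))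

  eP≤j⇔⊑-maximal : (π : BRel (n G)) → isEquivᵇ π ≡ true → (eP G π <ᵇ suc j) ≡ any (π ⊑_) (maximalUpTo G j)
  eP≤j⇔⊑-maximal π π-equiv = true-ext coarsen-π bound
    where
    coarsen-π : (eP G π <ᵇ suc j) ≡ true → any (π ⊑_) (maximalUpTo G j) ≡ true
    coarsen-π π≤j with coarsen (suc (unrelatedPairs π)) π ℕ.≤-refl (isEquivᵇ⇒IsEquiv π π-equiv) (ℕ.≤-pred (<ᵇ⇒< π≤j))
    ... | M , M∈ , π⊆M = any-intro (π ⊑_) (maximalUpTo G j) M∈ (⊆ᴿ⇒⊑ π M π⊆M)
    bound : any (π ⊑_) (maximalUpTo G j) ≡ true → (eP G π <ᵇ suc j) ≡ true
    bound π⊑some with any-elim (π ⊑_) (maximalUpTo G j) π⊑some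
    ... | M , M∈ , π⊑M with ∈maximalUpTo⁻ M∈
    ...   | i , i∈ , M-maximal = <⇒<ᵇ (begin-strict
      eP G π  ≤⟨ eP-mono G (⊑⇒⊆ᴿ π M π⊑M) ⟩
      eP G M  ≡⟨ ≡ᵇ⇒≡ (∧-elimˡ M-maximal) ⟩
      i       <⟨ ∈-upTo⁻ i∈ ⟩
      suc j   ∎)
      where open ℕ.≤-Reasoning

module Blocks {m : ℕ} (π : BRel m) (π-equiv : IsEquiv π) where
  open IsEquiv π-equiv

  isLeast : Fin m → Bool
  isLeast v = not (any (λ u → (toℕ u <ᵇ toℕ v) ∧ π u v) (allFin m))

  leaders : List (Fin m)
  leaders = filterᵇ isLeast (allFin m)

  block : Fin m → List (Fin m)
  block r = filterᵇ (π r) (allFin m)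

  size : Fin m → ℕ
  size r = length (block r)

  isLeast-unique : ∀ {a b} → isLeast a ≡ true → isLeast b ≡ true → π a b ≡ true → a ≡ b
  isLeast-unique {a} {b} la lb πab with ℕ.<-cmp (toℕ a) (toℕ b)
  ... | tri< a<b _ _ = ⊥-elim (false≢true (not-true⇒false lb)
          (any-intro (λ u → (toℕ u <ᵇ toℕ b) ∧ π u b) (allFin m) (∈-allFin a) (∧-intro (<⇒<ᵇ a<b) πab)))
  ... | tri≈ _ a≡b _ = Fin.toℕ-injective a≡b
  ... | tri> _ _ b<a = ⊥-elim (false≢true (not-true⇒false la)
          (any-intro (λ u → (toℕ u <ᵇ toℕ a) ∧ π u a) (allFin m) (∈-allFin b) (∧-intro (<⇒<ᵇ b<a) (symmetric πab))))

  leaderOf : ∀ v → Σ (Fin m) λ r → π v r ≡ true × isLeast r ≡ true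
  leaderOf v = descend (suc (toℕ v)) v ℕ.≤-refl
    where
    descend : (fuel : ℕ) (v : Fin m) → toℕ v < fuel → Σ (Fin m) λ r → π v r ≡ true × isLeast r ≡ true
    descend (suc fuel) v v<fuel with isLeast v in lv
    ... | true = v , reflexive v , lv
    ... | false with any-elim (λ u → (toℕ u <ᵇ toℕ v) ∧ π u v) (allFin m) (not-false⇒true lv)
    ...   | w , _ , w<v∧πwv with descend fuel w (ℕ.≤-trans (<ᵇ⇒< (∧-elimˡ w<v∧πwv)) (ℕ.≤-pred v<fuel))
    ...     | r , πwr , lr = r , transitive (symmetric (∧-elimʳ {toℕ w <ᵇ toℕ v} w<v∧πwv)) πwr , lr

  leaders-exactlyOnce : ∀ u → ∑ leaders (λ r → ⟦ π r u ⟧) ≡ 1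
  leaders-exactlyOnce u with leaderOf u
  ... | r₀ , πur₀ , lr₀ = trans (∑-filterᵇ isLeast (λ r → ⟦ π r u ⟧) (allFin m))
                                (trans (∑-cong (allFin m) leader≡δ) (∑-allFin-δ r₀))
    where
    leader≡δ : ∀ r → ⟦ isLeast r ⟧ * ⟦ π r u ⟧ ≡ ⟦ r₀ == r ⟧
    leader≡δ r = trans (sym (⟦∧⟧ (isLeast r) (π r u))) (cong ⟦_⟧ (true-ext
      (λ e → ≡⇒== (sym (isLeast-unique (∧-elimˡ e) lr₀ (transitive (∧-elimʳ {isLeast r} e) πur₀))))
      (λ e → subst (λ z → isLeast z ∧ π z u ≡ true) (==⇒≡ e) (∧-intro lr₀ (symmetric πur₀)))))

  AtMostOnce : List (Fin m) → Set
  AtMostOnce rs = ∀ u → ∑ rs (λ r → ⟦ π r u ⟧) ≤ 1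

  AtMostOnce-tail : ∀ {r rs} → AtMostOnce (r ∷ rs) → AtMostOnce rs
  AtMostOnce-tail {r} once u = ℕ.≤-trans (ℕ.m≤n+m _ ⟦ π r u ⟧) (once u)

  AtMostOnce-head : ∀ {r rs} → AtMostOnce (r ∷ rs) → ∀ {r′} → r′ ∈ rs → π r r′ ≡ false
  AtMostOnce-head {r} {rs} once {r′} r′∈ = ¬true⇒false λ πrr′ → ℕ.<-irrefl refl (begin-strict
    1                                    <⟨ s≤s (∑-positive (λ z → ⟦ π z r′ ⟧) rs r′∈ (ℕ.≤-reflexive (cong ⟦_⟧ (sym (reflexive r′))))) ⟩
    suc (∑ rs (λ z → ⟦ π z r′ ⟧))         ≡⟨ cong (λ b → ⟦ b ⟧ + ∑ rs (λ z → ⟦ π z r′ ⟧)) (sym πrr′) ⟩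
    ⟦ π r r′ ⟧ + ∑ rs (λ z → ⟦ π z r′ ⟧)  ≤⟨ once r′ ⟩
    1                                    ∎)
    where open ℕ.≤-Reasoning

  leaderAt : (rs : List (Fin m)) → Fin (length (map size rs)) → Fin m
  leaderAt (r ∷ rs) zero = r
  leaderAt (r ∷ rs) (suc b) = leaderAt rs b

  lookup-map-size : (rs : List (Fin m)) (b : Fin (length (map size rs))) → lookup (map size rs) b ≡ size (leaderAt rs b)
  lookup-map-size (r ∷ rs) zero = refl
  lookup-map-size (r ∷ rs) (suc b) = lookup-map-size rs b

  Once : List (Fin m) → Fin m → Set
  Once rs u = ∑ rs (λ r → ⟦ π r u ⟧) ≡ 1

  blockIndex : (rs : List (Fin m)) (u : Fin m) → Once rs u → Fin (length (map size rs))
  blockIndex (r ∷ rs) u once with π r u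
  ... | true = zero
  ... | false = suc (blockIndex rs u once)

  blockIndex-π : (rs : List (Fin m)) (u : Fin m) (once : Once rs u) → π (leaderAt rs (blockIndex rs u once)) u ≡ true
  blockIndex-π (r ∷ rs) u once with π r u in πru
  ... | true = πru
  ... | false = blockIndex-π rs u once

  leaderAt-counted : (rs : List (Fin m)) (b : Fin (length (map size rs))) → 1 ≤ ∑ rs (λ r → ⟦ π r (leaderAt rs b) ⟧)
  leaderAt-counted (r ∷ rs) zero rewrite reflexive r = s≤s z≤n
  leaderAt-counted (r ∷ rs) (suc b) = ℕ.≤-trans (leaderAt-counted rs b) (ℕ.m≤n+m _ _)

  blockIndex-leaderAt : (rs : List (Fin m)) (b : Fin (length (map size rs))) (once : Once rs (leaderAt rs b)) →
                        blockIndex rs (leaderAt rs b) once ≡ b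
  blockIndex-leaderAt (r ∷ rs) zero once with π r r in πrr
  ... | true = refl
  ... | false = ⊥-elim (false≢true πrr (reflexive r))
  blockIndex-leaderAt (r ∷ rs) (suc b) once with π r (leaderAt rs b)
  ... | true = ⊥-elim (ℕ.<-irrefl (sym once) (s≤s (leaderAt-counted rs b)))
  ... | false = cong suc (blockIndex-leaderAt rs b once)

  blockIndex-≡⇒π : (rs : List (Fin m)) {u v : Fin m} (ou : Once rs u) (ov : Once rs v) →
                   blockIndex rs u ou ≡ blockIndex rs v ov → π u v ≡ true
  blockIndex-≡⇒π rs {u} {v} ou ov e =
    transitive (symmetric (blockIndex-π rs u ou)) (subst (λ b → π (leaderAt rs b) v ≡ true) (sym e) (blockIndex-π rs v ov))

  π⇒blockIndex-≡ : (rs : List (Fin m)) {u v : Fin m} (ou : Once rs u) (ov : Once rs v) →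
                   π u v ≡ true → blockIndex rs u ou ≡ blockIndex rs v ov
  π⇒blockIndex-≡ (r ∷ rs) {u} {v} ou ov πuv with π r u in πru | π r v in πrv
  ... | true | true = refl
  ... | true | false = ⊥-elim (false≢true πrv (transitive πru πuv))
  ... | false | true = ⊥-elim (false≢true πru (transitive πrv (symmetric πuv)))
  ... | false | false = cong suc (π⇒blockIndex-≡ rs ou ov πuv)

  numBlocks : ℕ
  numBlocks = length (blockSizes π)

  rep : Fin numBlocks → Fin m
  rep = leaderAt leaders

  blockOf : Fin m → Fin numBlocks
  blockOf u = blockIndex leaders u (leaders-exactlyOnce u)

  rep-blockOf : ∀ u → π (rep (blockOf u)) u ≡ true
  rep-blockOf u = blockIndex-π leaders u (leaders-exactlyOnce u)

  blockOf-rep : ∀ b → blockOf (rep b) ≡ b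
  blockOf-rep b = blockIndex-leaderAt leaders b (leaders-exactlyOnce (rep b))

  blockOf-≡⇒π : ∀ u v → blockOf u ≡ blockOf v → π u v ≡ true
  blockOf-≡⇒π u v = blockIndex-≡⇒π leaders (leaders-exactlyOnce u) (leaders-exactlyOnce v)

  π⇒blockOf-≡ : ∀ u v → π u v ≡ true → blockOf u ≡ blockOf v
  π⇒blockOf-≡ u v = π⇒blockIndex-≡ leaders (leaders-exactlyOnce u) (leaders-exactlyOnce v)

  blockOf-count : ∀ b → ∑ (allFin m) (λ u → ⟦ blockOf u == b ⟧) ≡ lookup (blockSizes π) b
  blockOf-count b = begin
    ∑ (allFin m) (λ u → ⟦ blockOf u == b ⟧)  ≡⟨ ∑-cong (allFin m) (cong ⟦_⟧ ∘ in-block) ⟩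
    ∑ (allFin m) (λ u → ⟦ π (rep b) u ⟧)      ≡⟨ sym (countᵇ≡∑ (π (rep b)) (allFin m)) ⟩
    size (rep b)                             ≡⟨ sym (lookup-map-size leaders b) ⟩
    lookup (blockSizes π) b                  ∎
    where
    open ≡-Reasoning
    in-block : ∀ u → (blockOf u == b) ≡ π (rep b) u
    in-block u = true-ext (λ e → subst (λ z → π (rep z) u ≡ true) (==⇒≡ e) (rep-blockOf u))
                          (λ e → ≡⇒== (trans (π⇒blockOf-≡ u (rep b) (symmetric e)) (blockOf-rep b)))

  Unique-lookup-injective : {xs : List (Fin m)} → Unique xs → ∀ i j → lookup xs i ≡ lookup xs j → i ≡ j
  Unique-lookup-injective (_ ∷ _) zero zero _ = refl
  Unique-lookup-injective (x∉ ∷ _) zero (suc j) e = ⊥-elim (All.lookup x∉ (∈-lookup j) e)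
  Unique-lookup-injective (x∉ ∷ _) (suc i) zero e = ⊥-elim (All.lookup x∉ (∈-lookup i) (sym e))
  Unique-lookup-injective (_ ∷ u) (suc i) (suc j) e = cong suc (Unique-lookup-injective u i j e)

  lookup-block : ∀ r (i : Fin (size r)) → π r (lookup (block r) i) ≡ true
  lookup-block r i = proj₂ (∈-filterᵇ⁻ (π r) {allFin m} (∈-lookup i))

  lookup-block-injective : ∀ r (i j : Fin (size r)) → lookup (block r) i ≡ lookup (block r) j → i ≡ j
  lookup-block-injective r = Unique-lookup-injective (Unique.filter⁺ (T? ∘ π r) (Unique.allFin⁺ m))

  concatBlocks : (rs : List (Fin m)) → Fin (sum (map size rs)) → Fin m
  concatBlocks (r ∷ rs) x with splitAt (size r) x
  ... | inj₁ i = lookup (block r) i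
  ... | inj₂ x′ = concatBlocks rs x′

  concatBlocks-leader : ∀ rs x → Σ (Fin m) λ r → r ∈ rs × π r (concatBlocks rs x) ≡ true
  concatBlocks-leader (r ∷ rs) x with splitAt (size r) x
  ... | inj₁ i = r , here refl , lookup-block r i
  ... | inj₂ x′ with concatBlocks-leader rs x′
  ...   | r′ , r′∈ , πr′ = r′ , there r′∈ , πr′

  partOf-concatBlocks : ∀ rs → AtMostOnce rs → ∀ x y →
                 (partOf (map size rs) x ≡ᵇ partOf (map size rs) y) ≡ π (concatBlocks rs x) (concatBlocks rs y)
  partOf-concatBlocks (r ∷ rs) once x y with splitAt (size r) x | splitAt (size r) y
  ... | inj₁ i | inj₁ i′ = sym (transitive (symmetric (lookup-block r i)) (lookup-block r i′))
  ... | inj₁ i | inj₂ y′ with concatBlocks-leader rs y′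
  ...   | r′ , r′∈ , πr′ = sym (¬true⇒false λ πxy →
          false≢true (AtMostOnce-head {r} {rs} once r′∈) (transitive (transitive (lookup-block r i) πxy) (symmetric πr′)))
  partOf-concatBlocks (r ∷ rs) once x y | inj₂ x′ | inj₁ i′ with concatBlocks-leader rs x′
  ...   | r′ , r′∈ , πr′ = sym (¬true⇒false λ πxy →
          false≢true (AtMostOnce-head {r} {rs} once r′∈) (transitive (transitive (lookup-block r i′) (symmetric πxy)) (symmetric πr′)))
  partOf-concatBlocks (r ∷ rs) once x y | inj₂ x′ | inj₂ y′ = partOf-concatBlocks rs (AtMostOnce-tail {r} {rs} once) x′ y′

  concatBlocks-injective : ∀ rs → AtMostOnce rs → ∀ x y → concatBlocks rs x ≡ concatBlocks rs y → x ≡ y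
  concatBlocks-injective (r ∷ rs) once x y e with splitAt (size r) x in sx | splitAt (size r) y in sy
  ... | inj₁ i | inj₁ i′ =
    trans (sym (Fin.splitAt⁻¹-↑ˡ sx)) (trans (cong (_↑ˡ _) (lookup-block-injective r i i′ e)) (Fin.splitAt⁻¹-↑ˡ sy))
  ... | inj₁ i | inj₂ y′ with concatBlocks-leader rs y′
  ...   | r′ , r′∈ , πr′ = ⊥-elim (false≢true (AtMostOnce-head {r} {rs} once r′∈)
                              (transitive (lookup-block r i) (subst (λ z → π z r′ ≡ true) (sym e) (symmetric πr′))))
  concatBlocks-injective (r ∷ rs) once x y e | inj₂ x′ | inj₁ i′ with concatBlocks-leader rs x′
  ...   | r′ , r′∈ , πr′ = ⊥-elim (false≢true (AtMostOnce-head {r} {rs} once r′∈)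
                              (transitive (lookup-block r i′) (subst (λ z → π z r′ ≡ true) e (symmetric πr′))))
  concatBlocks-injective (r ∷ rs) once x y e | inj₂ x′ | inj₂ y′ =
    trans (sym (Fin.splitAt⁻¹-↑ʳ sx))
          (trans (cong (size r ↑ʳ_) (concatBlocks-injective rs (AtMostOnce-tail {r} {rs} once) x′ y′ e)) (Fin.splitAt⁻¹-↑ʳ sy))

  concatBlocks-surjective : ∀ rs u → Σ (Fin m) (λ r → r ∈ rs × π r u ≡ true) → Σ (Fin (sum (map size rs))) λ x → concatBlocks rs x ≡ u
  concatBlocks-surjective (r ∷ rs) u (r′ , r′∈ , πr′u) with π r u in πru
  ... | true = let u∈ = ∈-filterᵇ⁺ (π r) (∈-allFin u) πru in
    (Any.index u∈ ↑ˡ _) , trans (concatBlocks-↑ˡ (Any.index u∈)) (sym (Any.lookup-index u∈))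
    where
    concatBlocks-↑ˡ : ∀ i → concatBlocks (r ∷ rs) (i ↑ˡ sum (map size rs)) ≡ lookup (block r) i
    concatBlocks-↑ˡ i rewrite Fin.splitAt-↑ˡ (size r) i (sum (map size rs)) = refl
  ... | false with r′∈
  ...   | here refl = ⊥-elim (false≢true πru πr′u)
  ...   | there r′∈rs with concatBlocks-surjective rs u (r′ , r′∈rs , πr′u)
  ...     | x , concatBlocks-x = (size r ↑ʳ x) , trans (concatBlocks-↑ʳ x) concatBlocks-x
    where
    concatBlocks-↑ʳ : ∀ x → concatBlocks (r ∷ rs) (size r ↑ʳ x) ≡ concatBlocks rs x
    concatBlocks-↑ʳ x rewrite Fin.splitAt-↑ʳ (size r) (sum (map size rs)) x = refl

  leaders-AtMostOnce : AtMostOnce leaders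
  leaders-AtMostOnce u = ℕ.≤-reflexive (leaders-exactlyOnce u)

  -- G_λ has vertex set Fin (sum (blockSizes π)); its i-th stable set is the i-th block of π.
  toVertex : Fin (sum (blockSizes π)) → Fin m
  toVertex = concatBlocks leaders

  preimage : ∀ u → Σ (Fin (sum (blockSizes π))) λ x → toVertex x ≡ u
  preimage u with leaderOf u
  ... | r , πur , lr = concatBlocks-surjective leaders u (r , ∈-filterᵇ⁺ isLeast (∈-allFin r) lr , symmetric πur)

  fromVertex : Fin m → Fin (sum (blockSizes π))
  fromVertex u = proj₁ (preimage u)

  toVertex-fromVertex : ∀ u → toVertex (fromVertex u) ≡ u
  toVertex-fromVertex u = proj₂ (preimage u)

  fromVertex-toVertex : ∀ x → fromVertex (toVertex x) ≡ x
  fromVertex-toVertex x = concatBlocks-injective leaders leaders-AtMostOnce (fromVertex (toVertex x)) x (toVertex-fromVertex (toVertex x))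

  partOf-toVertex : ∀ x y → (partOf (blockSizes π) x ≡ᵇ partOf (blockSizes π) y) ≡ π (toVertex x) (toVertex y)
  partOf-toVertex = partOf-concatBlocks leaders leaders-AtMostOnce

-- Augmented monomials count colourings by kernel

hasWeight : {m N : ℕ} → (Fin N → ℕ) → (Fin m → Fin N) → Bool
hasWeight α κ = sameExpo α (expo κ)

sameExpo⇒≗ : {N : ℕ} (α β : Fin N → ℕ) → sameExpo α β ≡ true → ∀ col → α col ≡ β col
sameExpo⇒≗ α β e col = ≡ᵇ⇒≡ (allFin-elim (λ c → α c ≡ᵇ β c) e col)

≗⇒sameExpo : {N : ℕ} (α β : Fin N → ℕ) → (∀ col → α col ≡ β col) → sameExpo α β ≡ true
≗⇒sameExpo α β h = allFin-intro (λ c → α c ≡ᵇ β c) (≡⇒≡ᵇ ∘ h)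

expo≡∑ : {m N : ℕ} (κ : Fin m → Fin N) (col : Fin N) → expo κ col ≡ ∑ (allFin m) (λ v → ⟦ κ v == col ⟧)
expo≡∑ {m} κ col = countᵇ≡∑ (λ v → κ v == col) (allFin m)

expo-cong : {m N : ℕ} {κ κ′ : Fin m → Fin N} → (∀ u → κ u ≡ κ′ u) → ∀ col → expo κ col ≡ expo κ′ col
expo-cong {m} κ≗κ′ col = countᵇ-cong (allFin m) (λ v → cong (_== col) (κ≗κ′ v))

hasWeight-resp : {m N : ℕ} (α : Fin N → ℕ) {κ κ′ : Fin m → Fin N} → (∀ u → κ u ≡ κ′ u) →
                 hasWeight α κ ≡ true → hasWeight α κ′ ≡ true
hasWeight-resp α {κ} {κ′} κ≗κ′ w = ≗⇒sameExpo α (expo κ′) (λ col → trans (sameExpo⇒≗ α (expo κ) w col) (expo-cong κ≗κ′ col))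

module AugmentedMonomial {m : ℕ} (N : ℕ) (α : Fin N → ℕ) (π : BRel m) (π-equiv : isEquivᵇ π ≡ true) where
  open Blocks π (isEquivᵇ⇒IsEquiv π π-equiv)
  open IsEquiv (isEquivᵇ⇒IsEquiv π π-equiv)

  blockWeight : (Fin numBlocks → Fin N) → Fin N → ℕ
  blockWeight c col = ∑ (allFin numBlocks) (λ b → ⟦ c b == col ⟧ * lookup (blockSizes π) b)

  Injective : (Fin numBlocks → Fin N) → Set
  Injective c = ∀ a b → c a ≡ c b → a ≡ b

  isInjectiveᵇ : (Fin numBlocks → Fin N) → Bool
  isInjectiveᵇ c = all (λ i → all (λ j → (c i == c j) ⇒ᵇ (i == j)) (allFin numBlocks)) (allFin numBlocks)

  isTerm : (Fin numBlocks → Fin N) → Bool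
  isTerm c = isInjectiveᵇ c
           ∧ all (λ col → α col ≡ᵇ sum (map (lookup (blockSizes π)) (filterᵇ (λ i → c i == col) (allFin numBlocks)))) (allFin N)

  sum-filter≡blockWeight : ∀ c col → sum (map (lookup (blockSizes π)) (filterᵇ (λ i → c i == col) (allFin numBlocks))) ≡ blockWeight c col
  sum-filter≡blockWeight c col = ∑-filterᵇ (λ i → c i == col) (lookup (blockSizes π)) (allFin numBlocks)

  isTerm⇒ : ∀ c → isTerm c ≡ true → Injective c × (∀ col → α col ≡ blockWeight c col)
  isTerm⇒ c e =
    (λ a b ca≡cb → ==⇒≡ (⇒ᵇ-elim (allFin-elim _ (allFin-elim _ (∧-elimˡ e) a) b) (≡⇒== ca≡cb))) ,
    (λ col → trans (≡ᵇ⇒≡ (allFin-elim _ (∧-elimʳ {isInjectiveᵇ c} e) col))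
                   (sum-filter≡blockWeight c col))

  ⇒isTerm : ∀ c → Injective c → (∀ col → α col ≡ blockWeight c col) → isTerm c ≡ true
  ⇒isTerm c inj weight = ∧-intro
    (allFin-intro _ (λ a → allFin-intro _ (λ b → ⇒ᵇ-intro (≡⇒== ∘ inj a b ∘ ==⇒≡))))
    (allFin-intro _ (λ col → ≡⇒≡ᵇ (trans (weight col) (sym (sum-filter≡blockWeight c col)))))

  expo-∘blockOf : ∀ (c : Fin numBlocks → Fin N) col → expo (c ∘ blockOf) col ≡ blockWeight c col
  expo-∘blockOf c col = begin
    expo (c ∘ blockOf) col
      ≡⟨ expo≡∑ (c ∘ blockOf) col ⟩
    ∑ (allFin m) (λ u → ⟦ c (blockOf u) == col ⟧)
      ≡⟨ ∑-cong (allFin m) (λ u → sym (∑-δ (finEnumeration numBlocks) (λ b → ⟦ c b == col ⟧)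
                                           (cong (λ z → ⟦ c z == col ⟧) ∘ ==⇒≡) (blockOf u))) ⟩
    ∑ (allFin m) (λ u → ∑ (allFin numBlocks) (λ b → ⟦ blockOf u == b ⟧ * ⟦ c b == col ⟧))
      ≡⟨ ∑-swap (allFin m) (allFin numBlocks) (λ u b → ⟦ blockOf u == b ⟧ * ⟦ c b == col ⟧) ⟩
    ∑ (allFin numBlocks) (λ b → ∑ (allFin m) (λ u → ⟦ blockOf u == b ⟧ * ⟦ c b == col ⟧))
      ≡⟨ ∑-cong (allFin numBlocks) (λ b → trans (∑-cong (allFin m) (λ u → ℕ.*-comm ⟦ blockOf u == b ⟧ _))
                                       (trans (∑-*ˡ ⟦ c b == col ⟧ (λ u → ⟦ blockOf u == b ⟧) (allFin m))
                                              (cong (⟦ c b == col ⟧ *_) (blockOf-count b)))) ⟩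
    blockWeight c col ∎
    where open ≡-Reasoning

  hasKernel : (Fin m → Fin N) → Bool
  hasKernel κ = (kernel κ ≈ᴿ π) ∧ hasWeight α κ

  rep-κ : (κ : Fin m → Fin N) → kernel κ ≈ᴿ π ≡ true → ∀ u → κ (rep (blockOf u)) ≡ κ u
  rep-κ κ e u = ==⇒≡ (trans (≈ᴿ⇒≗ e (rep (blockOf u)) u) (rep-blockOf u))

  -- m̃_λ counts the injective colourings c of the blocks; c ∘ blockOf is the corresponding colouring of V.
  terms≃colourings : SubsetBijection (colourings numBlocks N) (colourings m N) isTerm hasKernel
  terms≃colourings = record
    { to = _∘ blockOf
    ; from = _∘ rep
    ; to-∈ = λ c e → let inj , weight = isTerm⇒ c e in ∧-intro
        (≗⇒≈ᴿ (λ u v → true-ext (blockOf-≡⇒π u v ∘ inj _ _ ∘ ==⇒≡) (≡⇒== ∘ cong c ∘ π⇒blockOf-≡ u v)))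
        (≗⇒sameExpo α (expo (c ∘ blockOf)) (λ col → trans (weight col) (sym (expo-∘blockOf c col))))
    ; from-∈ = λ κ e → ⇒isTerm (κ ∘ rep)
        (λ a b κa≡κb → trans (sym (blockOf-rep a))
          (trans (π⇒blockOf-≡ (rep a) (rep b) (trans (sym (≈ᴿ⇒≗ (∧-elimˡ e) (rep a) (rep b))) (≡⇒== κa≡κb))) (blockOf-rep b)))
        (λ col → trans (sameExpo⇒≗ α (expo κ) (∧-elimʳ {kernel κ ≈ᴿ π} e) col)
          (trans (expo-cong (sym ∘ rep-κ κ (∧-elimˡ e)) col) (expo-∘blockOf (κ ∘ rep) col)))
    ; from-to = λ c _ → ≗⇒≈ᶜ (cong c ∘ blockOf-rep)
    ; to-from = λ κ e → ≗⇒≈ᶜ (rep-κ κ (∧-elimˡ e))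
    ; p-resp = λ {c} {c′} c≈c′ e → let inj , weight = isTerm⇒ c e ; c≗c′ = ≈ᶜ⇒≗ {f = c} {c′} c≈c′ in
        ⇒isTerm c′ (λ a b e′ → inj a b (trans (c≗c′ a) (trans e′ (sym (c≗c′ b)))))
               (λ col → trans (weight col) (∑-cong (allFin numBlocks) (λ b → cong (λ z → ⟦ z == col ⟧ * lookup (blockSizes π) b) (c≗c′ b))))
    ; q-resp = λ {κ} {κ′} κ≈κ′ e → let κ≗κ′ = ≈ᶜ⇒≗ {f = κ} {κ′} κ≈κ′ in ∧-intro
        (≗⇒≈ᴿ {R = kernel κ′} {π} (λ u v → trans (cong₂ _==_ (sym (κ≗κ′ u)) (sym (κ≗κ′ v))) (≈ᴿ⇒≗ (∧-elimˡ e) u v)))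
        (hasWeight-resp α {κ} {κ′} κ≗κ′ (∧-elimʳ {kernel κ ≈ᴿ π} e))
    ; to-cong = λ c≈c′ → ≗⇒≈ᶜ (≈ᶜ⇒≗ {N = N} c≈c′ ∘ blockOf)
    ; from-cong = λ κ≈κ′ → ≗⇒≈ᶜ (≈ᶜ⇒≗ {N = N} κ≈κ′ ∘ rep) }

  mtilde-count : mtilde (blockSizes π) N α ≡ + ∑ (allFuns m (allFin N)) (λ κ → ⟦ hasKernel κ ⟧)
  mtilde-count = cong +_ (trans (countᵇ≡∑ isTerm (allFuns numBlocks (allFin N))) (count-bijection terms≃colourings))

-- Chromatic functions of complete multipartite graphs

module CompleteMultipartite (lam : List ℕ) where

  H : Graph
  H = completeMultipartite lam

  isProper : {N : ℕ} → (Fin (sum lam) → Fin N) → Bool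
  isProper κ = all (λ { (a , b) → not (κ a == κ b) }) (edges H)

  Proper : {N : ℕ} → (Fin (sum lam) → Fin N) → Set
  Proper κ = ∀ x y → (partOf lam x ≡ᵇ partOf lam y) ≡ false → κ x == κ y ≡ false

  isProper≡ : {N : ℕ} (κ : Fin (sum lam) → Fin N) → isProper κ ≡
    all (λ u → all (λ v → ((toℕ u <ᵇ toℕ v) ∧ not (partOf lam u ≡ᵇ partOf lam v)) ⇒ᵇ not (κ u == κ v))
                   (allFin (sum lam)))
        (allFin (sum lam))
  isProper≡ κ = trans (all-concatMap separated pairsFrom (allFin (sum lam)))
    (all-cong _ _ (allFin (sum lam)) (λ u →
      trans (all-map separated (u ,_) (filterᵇ (isEdge u) (allFin (sum lam))))
            (all-filterᵇ (λ v → separated (u , v)) (isEdge u) (allFin (sum lam)))))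
    where
    separated : Fin (sum lam) × Fin (sum lam) → Bool
    separated (a , b) = not (κ a == κ b)
    isEdge : Fin (sum lam) → Fin (sum lam) → Bool
    isEdge u v = (toℕ u <ᵇ toℕ v) ∧ not (partOf lam u ≡ᵇ partOf lam v)
    pairsFrom : Fin (sum lam) → List (Fin (sum lam) × Fin (sum lam))
    pairsFrom u = map (u ,_) (filterᵇ (isEdge u) (allFin (sum lam)))

  isProper-edge : {N : ℕ} (κ : Fin (sum lam) → Fin N) → isProper κ ≡ true →
                  ∀ u v → ((toℕ u <ᵇ toℕ v) ∧ not (partOf lam u ≡ᵇ partOf lam v)) ⇒ᵇ not (κ u == κ v) ≡ true
  isProper-edge κ e u v = allFin-elim _ (allFin-elim _ (trans (sym (isProper≡ κ)) e) u) v

  isProper⇒Proper : {N : ℕ} (κ : Fin (sum lam) → Fin N) → isProper κ ≡ true → Proper κ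
  isProper⇒Proper κ e x y differ with ℕ.<-cmp (toℕ x) (toℕ y)
  ... | tri< x<y _ _ = not-true⇒false (⇒ᵇ-elim (isProper-edge κ e x y) (∧-intro (<⇒<ᵇ x<y) (false⇒not-true differ)))
  ... | tri≈ _ x≡y _ = ⊥-elim (false≢true differ
          (subst (λ z → (partOf lam x ≡ᵇ partOf lam z) ≡ true) (Fin.toℕ-injective x≡y) (≡⇒≡ᵇ {partOf lam x} refl)))
  ... | tri> _ _ y<x = ¬true⇒false λ κx≡κy → false≢true
          (not-true⇒false (⇒ᵇ-elim (isProper-edge κ e y x)
            (∧-intro (<⇒<ᵇ y<x) (false⇒not-true (trans (≡ᵇ-sym (partOf lam y) (partOf lam x)) differ)))))
          (==-sym κx≡κy)

  Proper⇒isProper : {N : ℕ} (κ : Fin (sum lam) → Fin N) → Proper κ → isProper κ ≡ true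
  Proper⇒isProper κ proper = trans (isProper≡ κ) (allFin-intro _ (λ u → allFin-intro _ (λ v →
    ⇒ᵇ-intro (λ e → false⇒not-true (proper u v (not-true⇒false (∧-elimʳ {toℕ u <ᵇ toℕ v} e)))))))

module ChromaticMultipartite {m : ℕ} (N : ℕ) (α : Fin N → ℕ) (M : BRel m) (M-equiv : isEquivᵇ M ≡ true) where
  open Blocks M (isEquivᵇ⇒IsEquiv M M-equiv)
  open CompleteMultipartite (blockSizes M)

  count-∘toVertex : (f : Fin m → Bool) → ∑ (allFin (sum (blockSizes M))) (λ x → ⟦ f (toVertex x) ⟧) ≡ ∑ (allFin m) (λ u → ⟦ f u ⟧)
  count-∘toVertex f = count-bijection {EA = finEnumeration (sum (blockSizes M))} {EB = finEnumeration m} record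
    { to = toVertex
    ; from = fromVertex
    ; to-∈ = λ _ e → e
    ; from-∈ = λ u e → subst (λ z → f z ≡ true) (sym (toVertex-fromVertex u)) e
    ; from-to = λ x _ → ≡⇒== (fromVertex-toVertex x)
    ; to-from = λ u _ → ≡⇒== (toVertex-fromVertex u)
    ; p-resp = λ x≈x′ → subst (λ z → f (toVertex z) ≡ true) (==⇒≡ x≈x′)
    ; q-resp = λ u≈u′ → subst (λ z → f z ≡ true) (==⇒≡ u≈u′)
    ; to-cong = ≡⇒== ∘ cong toVertex ∘ ==⇒≡
    ; from-cong = ≡⇒== ∘ cong fromVertex ∘ ==⇒≡ }

  expo-∘toVertex : ∀ (κ : Fin m → Fin N) col → expo (κ ∘ toVertex) col ≡ expo κ col
  expo-∘toVertex κ col = trans (expo≡∑ (κ ∘ toVertex) col) (trans (count-∘toVertex (λ u → κ u == col)) (sym (expo≡∑ κ col)))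

  expo-∘fromVertex : ∀ (κ : Fin (sum (blockSizes M)) → Fin N) col → expo (κ ∘ fromVertex) col ≡ expo κ col
  expo-∘fromVertex κ col = trans (sym (expo-∘toVertex (κ ∘ fromVertex) col)) (expo-cong (cong κ ∘ fromVertex-toVertex) col)

  refinesM : (Fin m → Fin N) → Bool
  refinesM κ = (kernel κ ⊑ M) ∧ hasWeight α κ

  isColouring : (Fin (sum (blockSizes M)) → Fin N) → Bool
  isColouring κ = isProper κ ∧ hasWeight α κ

  -- A colouring of V whose colour classes lie inside blocks of M is a proper colouring of G_λ(M), read through toVertex.
  refining≃proper : SubsetBijection (colourings m N) (colourings (sum (blockSizes M)) N) refinesM isColouring
  refining≃proper = record
    { to = _∘ toVertex
    ; from = _∘ fromVertex
    ; to-∈ = λ κ e → ∧-intro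
        (Proper⇒isProper (κ ∘ toVertex) (λ x y differ → ¬true⇒false λ same → false≢true differ
          (trans (partOf-toVertex x y) (⊑⇒⊆ᴿ (kernel κ) M (∧-elimˡ e) (toVertex x) (toVertex y) same))))
        (≗⇒sameExpo α (expo (κ ∘ toVertex)) (λ col →
          trans (sameExpo⇒≗ α (expo κ) (∧-elimʳ {kernel κ ⊑ M} e) col) (sym (expo-∘toVertex κ col))))
    ; from-∈ = λ κ e → ∧-intro
        (⊆ᴿ⇒⊑ (kernel (κ ∘ fromVertex)) M (λ u v same → same-part κ (∧-elimˡ e) u v same _ refl))
        (≗⇒sameExpo α (expo (κ ∘ fromVertex)) (λ col →
          trans (sameExpo⇒≗ α (expo κ) (∧-elimʳ {isProper κ} e) col) (sym (expo-∘fromVertex κ col))))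
    ; from-to = λ κ _ → ≗⇒≈ᶜ (cong κ ∘ toVertex-fromVertex)
    ; to-from = λ κ _ → ≗⇒≈ᶜ (cong κ ∘ fromVertex-toVertex)
    ; p-resp = λ {κ} {κ′} κ≈κ′ e → let κ≗κ′ = ≈ᶜ⇒≗ {f = κ} {κ′} κ≈κ′ in ∧-intro
        (⊆ᴿ⇒⊑ (kernel κ′) M (λ u v same → ⊑⇒⊆ᴿ (kernel κ) M (∧-elimˡ e) u v (trans (cong₂ _==_ (κ≗κ′ u) (κ≗κ′ v)) same)))
        (hasWeight-resp α {κ} {κ′} κ≗κ′ (∧-elimʳ {kernel κ ⊑ M} e))
    ; q-resp = λ {κ} {κ′} κ≈κ′ e → let κ≗κ′ = ≈ᶜ⇒≗ {f = κ} {κ′} κ≈κ′ in ∧-intro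
        (Proper⇒isProper κ′ (λ x y differ → trans (cong₂ _==_ (sym (κ≗κ′ x)) (sym (κ≗κ′ y))) (isProper⇒Proper κ (∧-elimˡ e) x y differ)))
        (hasWeight-resp α {κ} {κ′} κ≗κ′ (∧-elimʳ {isProper κ} e))
    ; to-cong = λ κ≈κ′ → ≗⇒≈ᶜ (≈ᶜ⇒≗ {N = N} κ≈κ′ ∘ toVertex)
    ; from-cong = λ κ≈κ′ → ≗⇒≈ᶜ (≈ᶜ⇒≗ {N = N} κ≈κ′ ∘ fromVertex) }
    where
    same-part : (κ : Fin (sum (blockSizes M)) → Fin N) → isProper κ ≡ true → ∀ u v → κ (fromVertex u) == κ (fromVertex v) ≡ true →
                ∀ b → (partOf (blockSizes M) (fromVertex u) ≡ᵇ partOf (blockSizes M) (fromVertex v)) ≡ b → M u v ≡ true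
    same-part κ proper u v same true parts = subst₂ (λ a b → M a b ≡ true) (toVertex-fromVertex u) (toVertex-fromVertex v)
      (trans (sym (partOf-toVertex (fromVertex u) (fromVertex v))) parts)
    same-part κ proper u v same false parts = ⊥-elim (false≢true (isProper⇒Proper κ proper (fromVertex u) (fromVertex v) parts) same)

  r-count : r (blockSizes M) N α ≡ + ∑ (allFuns m (allFin N)) (λ κ → ⟦ refinesM κ ⟧)
  r-count = cong +_ (trans (countᵇ≡∑ isColouring (allFuns (sum (blockSizes M)) (allFin N))) (sym (count-bijection refining≃proper)))

-- Both sides as sums over colourings

module ColouringExpansion (G : Graph) (j : ℕ) (N : ℕ) (α : Fin N → ℕ) where
  open Enumeration (relations (n G)) using () renaming (elements to relationsOnV)

  colouringsOfV : List (Fin (n G) → Fin N)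
  colouringsOfV = allFuns (n G) (allFin N)

  kernelCount : BRel (n G) → ℕ
  kernelCount π = ∑ colouringsOfV (λ κ → ⟦ (kernel κ ≈ᴿ π) ∧ hasWeight α κ ⟧)

  tutteCoeff-count : ∀ i → tutteCoeff G i N α ≡ + ∑ (setPartitions (n G)) (λ π → ⟦ eP G π ≡ᵇ i ⟧ * kernelCount π)
  tutteCoeff-count i = trans (ΣSF-apply (setPartitions (n G)) term N α)
                             (trans (∑ℤ-congᴬ (setPartitions (n G)) (setPartitions-isEquivᵇ (n G)) term-count) (∑ℤ-ℕ _ (setPartitions (n G))))
    where
    term : BRel (n G) → SF
    term π = if eP G π ≡ᵇ i then mtilde (blockSizes π) else 0SF
    term-count : ∀ π → isEquivᵇ π ≡ true → term π N α ≡ + (⟦ eP G π ≡ᵇ i ⟧ * kernelCount π)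
    term-count π π-equiv with eP G π ≡ᵇ i
    ... | true = trans (AugmentedMonomial.mtilde-count N α π π-equiv)
                       (cong +_ (sym (ℕ.+-identityʳ (kernelCount π))))
    ... | false = refl

  -- Every colouring has exactly one kernel, so summing over partitions π and the colourings with kernel π
  -- is summing over colourings.
  ∑-partitions-kernelCount : (f : BRel (n G) → ℕ) → (∀ {R T} → R ≈ᴿ T ≡ true → f R ≡ f T) →
    ∑ (setPartitions (n G)) (λ π → kernelCount π * f π) ≡ ∑ colouringsOfV (λ κ → ⟦ hasWeight α κ ⟧ * f (kernel κ))
  ∑-partitions-kernelCount f f-resp = begin
    ∑ (setPartitions (n G)) (λ π → kernelCount π * f π)
      ≡⟨ ∑-filterᵇ isEquivᵇ (λ π → kernelCount π * f π) relationsOnV ⟩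
    ∑ relationsOnV (λ π → ⟦ isEquivᵇ π ⟧ * (kernelCount π * f π))
      ≡⟨ ∑-cong relationsOnV spread ⟩
    ∑ relationsOnV (λ π → ∑ colouringsOfV (λ κ → ⟦ kernel κ ≈ᴿ π ⟧ * g κ π))
      ≡⟨ ∑-swap relationsOnV colouringsOfV (λ π κ → ⟦ kernel κ ≈ᴿ π ⟧ * g κ π) ⟩
    ∑ colouringsOfV (λ κ → ∑ relationsOnV (λ π → ⟦ kernel κ ≈ᴿ π ⟧ * g κ π))
      ≡⟨ ∑-cong colouringsOfV (λ κ → ∑-δ (relations (n G)) (g κ) (g-resp κ) (kernel κ)) ⟩
    ∑ colouringsOfV (λ κ → g κ (kernel κ))
      ≡⟨ ∑-cong colouringsOfV (λ κ → cong (λ b → ⟦ hasWeight α κ ⟧ * (⟦ b ⟧ * f (kernel κ))) (kernel-isEquivᵇ κ)) ⟩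
    ∑ colouringsOfV (λ κ → ⟦ hasWeight α κ ⟧ * (1 * f (kernel κ)))
      ≡⟨ ∑-cong colouringsOfV (λ κ → cong (⟦ hasWeight α κ ⟧ *_) (ℕ.*-identityˡ (f (kernel κ)))) ⟩
    ∑ colouringsOfV (λ κ → ⟦ hasWeight α κ ⟧ * f (kernel κ)) ∎
    where
    open ≡-Reasoning
    g : (Fin (n G) → Fin N) → BRel (n G) → ℕ
    g κ π = ⟦ hasWeight α κ ⟧ * (⟦ isEquivᵇ π ⟧ * f π)
    g-resp : ∀ κ {R T} → R ≈ᴿ T ≡ true → g κ R ≡ g κ T
    g-resp κ {R} {T} R≈T = cong₂ (λ b x → ⟦ hasWeight α κ ⟧ * (⟦ b ⟧ * x)) (isEquivᵇ-resp {R = R} {T} R≈T) (f-resp R≈T)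
    spread : ∀ π → ⟦ isEquivᵇ π ⟧ * (kernelCount π * f π) ≡ ∑ colouringsOfV (λ κ → ⟦ kernel κ ≈ᴿ π ⟧ * g κ π)
    spread π = sym (begin
      ∑ colouringsOfV (λ κ → ⟦ kernel κ ≈ᴿ π ⟧ * g κ π)
        ≡⟨ ∑-cong colouringsOfV (λ κ → trans (regroup ⟦ kernel κ ≈ᴿ π ⟧ ⟦ hasWeight α κ ⟧ ⟦ isEquivᵇ π ⟧ (f π))
                                             (cong ((⟦ isEquivᵇ π ⟧ * f π) *_) (sym (⟦∧⟧ (kernel κ ≈ᴿ π) (hasWeight α κ))))) ⟩
      ∑ colouringsOfV (λ κ → (⟦ isEquivᵇ π ⟧ * f π) * ⟦ (kernel κ ≈ᴿ π) ∧ hasWeight α κ ⟧)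
        ≡⟨ ∑-*ˡ (⟦ isEquivᵇ π ⟧ * f π) (λ κ → ⟦ (kernel κ ≈ᴿ π) ∧ hasWeight α κ ⟧) colouringsOfV ⟩
      (⟦ isEquivᵇ π ⟧ * f π) * kernelCount π
        ≡⟨ regroup′ ⟦ isEquivᵇ π ⟧ (f π) (kernelCount π) ⟩
      ⟦ isEquivᵇ π ⟧ * (kernelCount π * f π) ∎)
      where
      regroup : ∀ a b c d → a * (b * (c * d)) ≡ (c * d) * (a * b)
      regroup = ℕ-Solver.solve-∀
      regroup′ : ∀ c d k → (c * d) * k ≡ c * (k * d)
      regroup′ = ℕ-Solver.solve-∀

  tutteCoeffs-count : ΣSF (upTo (suc j)) (tutteCoeff G) N α ≡
                      + ∑ colouringsOfV (λ κ → ⟦ hasWeight α κ ⟧ * ⟦ eP G (kernel κ) <ᵇ suc j ⟧)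
  tutteCoeffs-count = begin
    ΣSF (upTo (suc j)) (tutteCoeff G) N α
      ≡⟨ ΣSF-apply (upTo (suc j)) (tutteCoeff G) N α ⟩
    ∑ℤ (upTo (suc j)) (λ i → tutteCoeff G i N α)
      ≡⟨ trans (∑ℤ-cong (upTo (suc j)) tutteCoeff-count) (∑ℤ-ℕ _ (upTo (suc j))) ⟩
    + ∑ (upTo (suc j)) (λ i → ∑ partitions (λ π → ⟦ eP G π ≡ᵇ i ⟧ * kernelCount π))
      ≡⟨ cong +_ (∑-swap (upTo (suc j)) partitions (λ i π → ⟦ eP G π ≡ᵇ i ⟧ * kernelCount π)) ⟩
    + ∑ partitions (λ π → ∑ (upTo (suc j)) (λ i → ⟦ eP G π ≡ᵇ i ⟧ * kernelCount π))
      ≡⟨ cong +_ (∑-cong partitions eP≤j) ⟩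
    + ∑ partitions (λ π → kernelCount π * ⟦ eP G π <ᵇ suc j ⟧)
      ≡⟨ cong +_ (∑-partitions-kernelCount (λ π → ⟦ eP G π <ᵇ suc j ⟧)
                    (λ {R} {T} R≈T → cong (λ e → ⟦ e <ᵇ suc j ⟧) (eP-resp G {R} {T} R≈T))) ⟩
    + ∑ colouringsOfV (λ κ → ⟦ hasWeight α κ ⟧ * ⟦ eP G (kernel κ) <ᵇ suc j ⟧) ∎
    where
    open ≡-Reasoning
    partitions = setPartitions (n G)
    eP≤j : ∀ π → ∑ (upTo (suc j)) (λ i → ⟦ eP G π ≡ᵇ i ⟧ * kernelCount π) ≡ kernelCount π * ⟦ eP G π <ᵇ suc j ⟧
    eP≤j π = begin
      ∑ (upTo (suc j)) (λ i → ⟦ eP G π ≡ᵇ i ⟧ * kernelCount π) ≡⟨ ∑-cong (upTo (suc j)) (λ i → ℕ.*-comm _ (kernelCount π)) ⟩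
      ∑ (upTo (suc j)) (λ i → kernelCount π * ⟦ eP G π ≡ᵇ i ⟧) ≡⟨ ∑-*ˡ (kernelCount π) (λ i → ⟦ eP G π ≡ᵇ i ⟧) (upTo (suc j)) ⟩
      kernelCount π * ∑ (upTo (suc j)) (λ i → ⟦ eP G π ≡ᵇ i ⟧) ≡⟨ cong (kernelCount π *_) (∑-upTo-δ (suc j) (eP G π)) ⟩
      kernelCount π * ⟦ eP G π <ᵇ suc j ⟧ ∎

  maximal = maximalUpTo G j

  maximal-isEquivᵇ : All (λ M → isEquivᵇ M ≡ true) maximal
  maximal-isEquivᵇ = All.filter⁺ _ (setPartitions-isEquivᵇ (n G))

  signed-r-count : ∀ S → All (λ M → isEquivᵇ M ≡ true) S → sign S *ℤ r (blockSizes (meet S)) N α ≡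
                   ∑ℤ colouringsOfV (λ κ → (sign S *ℤ + ⟦ all (kernel κ ⊑_) S ⟧) *ℤ + ⟦ hasWeight α κ ⟧)
  signed-r-count S S-equiv = begin
    sign S *ℤ r (blockSizes (meet S)) N α
      ≡⟨ cong (sign S *ℤ_) (ChromaticMultipartite.r-count N α (meet S) (IsEquiv⇒isEquivᵇ (meet S) (meet-IsEquiv S S-equiv))) ⟩
    sign S *ℤ + ∑ colouringsOfV (λ κ → ⟦ (kernel κ ⊑ meet S) ∧ hasWeight α κ ⟧)
      ≡⟨ cong (sign S *ℤ_) (sym (∑ℤ-ℕ _ colouringsOfV)) ⟩
    sign S *ℤ ∑ℤ colouringsOfV (λ κ → + ⟦ (kernel κ ⊑ meet S) ∧ hasWeight α κ ⟧)
      ≡⟨ sym (∑ℤ-*ˡ (sign S) _ colouringsOfV) ⟩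
    ∑ℤ colouringsOfV (λ κ → sign S *ℤ + ⟦ (kernel κ ⊑ meet S) ∧ hasWeight α κ ⟧)
      ≡⟨ ∑ℤ-cong colouringsOfV (λ κ → trans (cong (sign S *ℤ_) (factor κ)) (sym (ℤ.*-assoc (sign S) _ _))) ⟩
    ∑ℤ colouringsOfV (λ κ → (sign S *ℤ + ⟦ all (kernel κ ⊑_) S ⟧) *ℤ + ⟦ hasWeight α κ ⟧) ∎
    where
    open ≡-Reasoning
    factor : ∀ κ → + ⟦ (kernel κ ⊑ meet S) ∧ hasWeight α κ ⟧ ≡ + ⟦ all (kernel κ ⊑_) S ⟧ *ℤ + ⟦ hasWeight α κ ⟧
    factor κ = trans (cong +_ (trans (⟦∧⟧ (kernel κ ⊑ meet S) (hasWeight α κ))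
                                     (cong (λ b → ⟦ b ⟧ * ⟦ hasWeight α κ ⟧) (⊑-meet (kernel κ) S))))
                     (ℤ.pos-* ⟦ all (kernel κ ⊑_) S ⟧ ⟦ hasWeight α κ ⟧)

  meets-count : ΣSF (nonemptySubs maximal) (λ S → ((- (+ 1)) ^ (length S ∸ 1)) ·SF r (blockSizes (meet S))) N α ≡
                + ∑ colouringsOfV (λ κ → ⟦ hasWeight α κ ⟧ * ⟦ any (kernel κ ⊑_) maximal ⟧)
  meets-count = begin
    ΣSF (nonemptySubs maximal) (λ S → ((- (+ 1)) ^ (length S ∸ 1)) ·SF r (blockSizes (meet S))) N α
      ≡⟨ ΣSF-apply (nonemptySubs maximal) (λ S → ((- (+ 1)) ^ (length S ∸ 1)) ·SF r (blockSizes (meet S))) N α ⟩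
    ∑ℤ (nonemptySubs maximal) (λ S → sign S *ℤ r (blockSizes (meet S)) N α)
      ≡⟨ ∑ℤ-congᴬ (nonemptySubs maximal) (nonemptySubs-All maximal maximal-isEquivᵇ) signed-r-count ⟩
    ∑ℤ (nonemptySubs maximal) (λ S → ∑ℤ colouringsOfV (λ κ → signed S κ *ℤ + ⟦ hasWeight α κ ⟧))
      ≡⟨ ∑ℤ-swap (nonemptySubs maximal) colouringsOfV (λ S κ → signed S κ *ℤ + ⟦ hasWeight α κ ⟧) ⟩
    ∑ℤ colouringsOfV (λ κ → ∑ℤ (nonemptySubs maximal) (λ S → signed S κ *ℤ + ⟦ hasWeight α κ ⟧))
      ≡⟨ ∑ℤ-cong colouringsOfV (λ κ → ∑ℤ-*ʳ (+ ⟦ hasWeight α κ ⟧) (λ S → signed S κ) (nonemptySubs maximal)) ⟩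
    ∑ℤ colouringsOfV (λ κ → ∑ℤ (nonemptySubs maximal) (λ S → signed S κ) *ℤ + ⟦ hasWeight α κ ⟧)
      ≡⟨ ∑ℤ-cong colouringsOfV (λ κ → cong (_*ℤ + ⟦ hasWeight α κ ⟧) (inclusion-exclusion (kernel κ ⊑_) maximal)) ⟩
    ∑ℤ colouringsOfV (λ κ → + ⟦ any (kernel κ ⊑_) maximal ⟧ *ℤ + ⟦ hasWeight α κ ⟧)
      ≡⟨ ∑ℤ-cong colouringsOfV (λ κ → trans (ℤ.*-comm (+ ⟦ any (kernel κ ⊑_) maximal ⟧) _) (sym (ℤ.pos-* ⟦ hasWeight α κ ⟧ _))) ⟩
    ∑ℤ colouringsOfV (λ κ → + (⟦ hasWeight α κ ⟧ * ⟦ any (kernel κ ⊑_) maximal ⟧))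
      ≡⟨ ∑ℤ-ℕ _ colouringsOfV ⟩
    + ∑ colouringsOfV (λ κ → ⟦ hasWeight α κ ⟧ * ⟦ any (kernel κ ⊑_) maximal ⟧) ∎
    where
    open ≡-Reasoning
    signed : List (BRel (n G)) → (Fin (n G) → Fin N) → ℤ
    signed S κ = sign S *ℤ + ⟦ all (kernel κ ⊑_) S ⟧

theorem3p2 : (G : Graph) (j : ℕ) →
    ΣSF (upTo (suc j)) (λ i → tutteCoeff G i)
      ≈SF ΣSF (nonemptySubs (maximalUpTo G j))
            (λ S → ((- (+ 1)) ^ (length S ∸ 1)) ·SF r (blockSizes (meet S)))
theorem3p2 G j N α = begin
  ΣSF (upTo (suc j)) (tutteCoeff G) N α
    ≡⟨ tutteCoeffs-count ⟩
  + ∑ colouringsOfV (λ κ → ⟦ hasWeight α κ ⟧ * ⟦ eP G (kernel κ) <ᵇ suc j ⟧)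
    ≡⟨ cong +_ (∑-cong colouringsOfV λ κ →
         cong (λ b → ⟦ hasWeight α κ ⟧ * ⟦ b ⟧) (Coarsening.eP≤j⇔⊑-maximal G j (kernel κ) (kernel-isEquivᵇ κ))) ⟩
  + ∑ colouringsOfV (λ κ → ⟦ hasWeight α κ ⟧ * ⟦ any (kernel κ ⊑_) (maximalUpTo G j) ⟧)
    ≡⟨ sym meets-count ⟩
  ΣSF (nonemptySubs (maximalUpTo G j)) (λ S → ((- (+ 1)) ^ (length S ∸ 1)) ·SF r (blockSizes (meet S))) N α ∎
  where
  open ≡-Reasoning
  open ColouringExpansion G j N α
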